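{- Let $\mathcal M\subset\mathbb Z^2$ be a minimal subgraph. Then there do not exist two disjoint infinite simple paths in $\mathbb Z^2$, all of whose vertices lie in $\delta\mathcal M$, which are both contained in some unbounded half-strip isometric to $[0,d]\times[0,\infty)$ for some constant $d>0$.
   Context: $\mathbb Z^2$ is the integer lattice graph ($x\sim y$ iff $|x-y|=1$). For $\Omega\subset\mathbb Z^2$: $\tau\Omega=\{z\notin\Omega:\exists w\in\Omega,z\sim w\}$, $\overline\Omega=\Omega\cup\tau\Omega$, $E_\Omega$ = edges $\{x,y\}$ with $x\in\Omega,y\in\overline\Omega$, $\partial K$ = edges with exactly one endpoint in $K$, $\delta\Omega=\{x\in\Omega:x\text{ has a neighbor not in }\Omega\}$. A proper nonempty $\mathcal M\subset\mathbb Z^2$ is minimal if for every finite $U$ and every $\hat K\subset\overline U$ with $\hat K\cap\tau U=\mathcal M\cap\tau U$, $|\partial\mathcal M\cap E_U|\le|\partial\hat K\cap E_U|$. A simple path has pairwise distinct vertices. -}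

module Defs where

open import Data.Bool using (Bool; true; false; _∨_; _xor_; if_then_else_)
open import Data.Nat as ℕ using (ℕ; zero; suc)
open import Data.Integer as ℤ using (ℤ; +_; -[1+_])
open import Data.Rational as ℚ using (ℚ)
open import Data.List using (List; map; upTo; concatMap; length; filter)
open import Data.Product using (_×_; _,_; Σ; ∃; proj₁; proj₂)
open import Data.Sum using (_⊎_)
open import Relation.Binary.PropositionalEquality using (_≡_; _≢_)
open import Relation.Nullary using (¬_)

Pt : Set
Pt = ℤ × ℤ

-- x ∼ y iff |x - y| = 1 (Euclidean = ℓ¹ distance 1 on ℤ²)
Adj : Pt → Pt → Set
Adj (x₁ , x₂) (y₁ , y₂) = ℤ.∣ x₁ ℤ.- y₁ ∣ ℕ.+ ℤ.∣ x₂ ℤ.- y₂ ∣ ≡ 1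

Subset : Set
Subset = Pt → Bool

record FinSubset : Set where
  field
    mem     : Subset
    bound   : ℕ
    bounded : ∀ z → mem z ≡ true →
              (ℤ.∣ proj₁ z ∣ ℕ.≤ bound) × (ℤ.∣ proj₂ z ∣ ℕ.≤ bound)
open FinSubset public

InTau : Subset → Pt → Set
InTau Ω z = (Ω z ≡ false) × ∃ λ w → (Ω w ≡ true) × Adj z w

InClosure : Subset → Pt → Set
InClosure Ω z = (Ω z ≡ true) ⊎ InTau Ω z

InDelta : Subset → Pt → Set
InDelta Ω x = (Ω x ≡ true) × ∃ λ y → Adj x y × (Ω y ≡ false)

-- Counting |∂K ∩ E_U| for finite U.
-- Every edge of ℤ² is written uniquely as {x , x + e} with e ∈ {(1,0),(0,1)}.
-- E_U = edges with at least one endpoint in U (the other endpoint is then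
-- automatically in the closure of U). If U ⊆ [-N,N]², every such edge has
-- its base point x in [-N-1,N]², so we enumerate that box.

-- the integers -N-1, …, N
range : ℕ → List ℤ
range N = map (λ k → (+ k) ℤ.- (+ suc N)) (upTo (suc (suc (N ℕ.+ N))))

box : ℕ → List Pt
box N = concatMap (λ i → map (λ j → (i , j)) (range N)) (range N)

right up : Pt → Pt
right (i , j) = (i ℤ.+ + 1 , j)
up    (i , j) = (i , j ℤ.+ + 1)

countEdge : FinSubset → Subset → Pt → (Pt → Pt) → ℕ
countEdge U K x e =
  if (mem U x ∨ mem U (e x)) Data.Bool.∧ (K x xor K (e x)) then 1 else 0

sumℕ : List ℕ → ℕ
sumℕ = Data.List.foldr ℕ._+_ 0

boundaryCount : FinSubset → Subset → ℕ
boundaryCount U K =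
  sumℕ (map (λ x → countEdge U K x right ℕ.+ countEdge U K x up) (box (bound U)))

Proper : Subset → Set
Proper M = (∃ λ z → M z ≡ true) × (∃ λ z → M z ≡ false)

Minimal : Subset → Set
Minimal M =
  Proper M ×
  ((U : FinSubset) (K : Subset) →
     (∀ z → K z ≡ true → InClosure (mem U) z) →
     (∀ z → InTau (mem U) z → K z ≡ M z) →
     boundaryCount U M ℕ.≤ boundaryCount U K)

record InfSimplePath : Set where
  field
    vert   : ℕ → Pt
    step   : ∀ n → Adj (vert n) (vert (suc n))
    simple : ∀ m n → vert m ≡ vert n → m ≡ n
open InfSimplePath public

-- Real numbers (Bishop's regular sequences of rationals):
-- x is represented by (xₙ) with |xₘ - xₙ| ≤ 1/(m+1) + 1/(n+1);
-- its limit x satisfies |x - xₙ| ≤ 1/(n+1).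

record ℝ : Set where
  field
    seq     : ℕ → ℚ
    regular : ∀ m n → ℚ.∣ seq m ℚ.- seq n ∣ ℚ.≤ ((+ 1) ℚ./ suc m) ℚ.+ ((+ 1) ℚ./ suc n)
open ℝ public

ℤtoℚ : ℤ → ℚ
ℤtoℚ k = k ℚ./ 1

-- p·c + q·s as seen at precision n, and its error bound (|p|+|q|)/(n+1)
approx : ℤ → ℤ → ℝ → ℝ → ℕ → ℚ
approx p q c s n = (ℤtoℚ p ℚ.* seq c n) ℚ.+ (ℤtoℚ q ℚ.* seq s n)

err : ℤ → ℤ → ℕ → ℚ
err p q n = (+ (ℤ.∣ p ∣ ℕ.+ ℤ.∣ q ∣)) ℚ./ suc n

-- a ≤ p·c + q·s   (for integers a,p,q and reals c,s)
LinGE : ℤ → ℤ → ℤ → ℝ → ℝ → Set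
LinGE a p q c s = ∀ n → ℤtoℚ a ℚ.≤ approx p q c s n ℚ.+ err p q n

-- p·c + q·s ≤ b
LinLE : ℤ → ℤ → ℤ → ℝ → ℝ → Set
LinLE b p q c s = ∀ n → approx p q c s n ℚ.≤ ℤtoℚ b ℚ.+ err p q n

-- x ≠ 0 (apartness)
NonZeroℝ : ℝ → Set
NonZeroℝ x = ∃ λ n → ((+ 1) ℚ./ suc n) ℚ.< ℚ.∣ seq x n ∣

-- Half-strips of ℝ² (images of [0,d]×[0,∞), d > 0, under isometries of ℝ²).
-- Such a half-strip is { z : α ≤ z·w ≤ α + d , z·w⊥ ≥ β } for a unit vector
-- w = (c,s), w⊥ = (-s,c).  Since d is existentially quantified and only
-- containment matters, we may allow any nonzero w and integer bounds a < b, e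
-- (rounding α down and α+d, β outward only enlarges the half-strip, and
-- rescaling w rescales the strip's width).

record HalfStrip : Set where
  field
    c s     : ℝ
    w≢0     : NonZeroℝ c ⊎ NonZeroℝ s
    a b e   : ℤ
    a<b     : a ℤ.< b

-- z ∈ H :  a ≤ z·(c,s) ≤ b  and  z·(-s,c) ≥ e ,  i.e.  e ≤ q·c + p·(-s)
InHalfStrip : HalfStrip → Pt → Set
InHalfStrip H (p , q) =
  LinGE a p q c s × LinLE b p q c s × LinGE e q (ℤ.- p) c s
  where open HalfStrip H

TwoPathsInStrip : Subset → Set
TwoPathsInStrip M =
  Σ InfSimplePath λ P → Σ InfSimplePath λ Q →
    (∀ n → InDelta M (vert P n)) ×
    (∀ n → InDelta M (vert Q n)) ×
    (∀ m n → vert P m ≢ vert Q n) ×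
    (Σ HalfStrip λ H → (∀ n → InHalfStrip H (vert P n)) × (∀ n → InHalfStrip H (vert Q n)))

{-# OPTIONS --safe #-}

-- A minimal set M obeys an isoperimetric bound: a rectangle R of semiperimeter w + h contains at
-- most w + h + 2 points of δM.  Filling R or emptying it (keeping M only on the cells around R)
-- gives competitors that agree with M on τR, so neither has fewer boundary edges than M in E_R;
-- distinct points of δM in R give distinct boundary edges of M, while every edge leaving R is a
-- boundary edge of exactly one of the two competitors.
--
-- After a quarter turn the half-strip points upward.  Between two rows its points stay within a
-- fixed number d of columns of the chord joining any two of its points on those rows, and only
-- finitely many of them lie below any row, so each path eventually crosses the band of height
-- h = 2d + 1 above both starting points.  The first crossing takes at least Δ + h steps, where Δ
-- is the horizontal distance between its ends, the second at least h, and all their points are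
-- distinct points of δM in a rectangle of semiperimeter Δ + 2d + h: the isoperimetric bound
-- forces h ≤ 2d.

module Submission where

open import Data.Bool using (Bool; true; false; _∧_; _∨_; _xor_; not; if_then_else_; T)
open import Data.Bool.Properties using (T-≡; ∨-zeroʳ; ∧-identityʳ; ∧-distribʳ-xor; ∧-distribˡ-xor)
open import Data.Empty using (⊥; ⊥-elim)
open import Data.Integer as ℤ using (ℤ; +_; -[1+_]; +≤+)
import Data.Integer.Properties as ℤ
open import Data.Integer.Tactic.RingSolver using (solve-∀)
open import Data.List using (List; []; _∷_; map; length; _++_; concatMap; upTo; filter)
open import Data.List.Membership.Propositional using (_∈_; lose)
open import Data.List.Membership.Propositional.Properties
open import Data.List.Properties
  using (length-map; length-upTo; length-removeAt′; length-++; map-++; map-cong; map-∘; map-id-local)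
open import Data.List.Relation.Binary.Subset.Propositional using (_⊆_)
open import Data.List.Relation.Unary.All using (All; []; _∷_)
import Data.List.Relation.Unary.All as All
import Data.List.Relation.Unary.All.Properties as All
open import Data.List.Relation.Unary.AllPairs using ([]; _∷_)
open import Data.List.Relation.Unary.Any using (Any; here; there; _─_; any?)
import Data.List.Relation.Unary.Any as Any
open import Data.List.Relation.Unary.Unique.Propositional using (Unique)
import Data.List.Relation.Unary.Unique.Propositional.Properties as Unique
open import Data.Nat as ℕ using (ℕ; zero; suc; z≤n; s≤s)
open import Data.Nat.Coprimality as Coprime using ()
open import Data.Nat.ListAction.Properties using (sum-++)
import Data.Nat.Properties as ℕ
open import Algebra.Properties.CommutativeSemigroup ℕ.+-commutativeSemigroup
  using () renaming (interchange to +-interchange)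
open import Data.Nat.Tactic.RingSolver using () renaming (solve-∀ to ℕ-solve-∀)
open import Data.Product using (_×_; _,_; proj₁; proj₂; ∃)
open import Data.Rational as ℚ using (ℚ; mkℚ; _/_; 0ℚ; 1ℚ; *≤*; *<*; _≤_; _<_; _+_; _*_; _-_; -_; ∣_∣; ↥_)
import Data.Rational.Properties as ℚ
open import Data.Sum as Sum using (_⊎_; inj₁; inj₂)
open import Function using (_∘_; Equivalence)
open import Level using (0ℓ)
open import Relation.Binary.PropositionalEquality
open import Relation.Nullary using (¬_; Dec; yes; no; does; contradiction; _×-dec_)
open import Relation.Nullary.Decidable using (T?; dec-true; dec⇒maybe)
open import Tactic.RingSolver using () renaming (solve-∀ to ring-solve-∀)
open import Tactic.RingSolver.Core.AlmostCommutativeRing using (AlmostCommutativeRing; fromCommutativeRing)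

open import Defs

private
  variable
    A B : Set

∈-─ : ∀ {x y} {ys : List A} (x∈ys : x ∈ ys) → y ∈ ys → x ≢ y → y ∈ (ys ─ x∈ys)
∈-─ (here refl) (here refl) x≢y = contradiction refl x≢y
∈-─ (here refl) (there y∈ys) _ = y∈ys
∈-─ (there x∈ys) (here refl) _ = here refl
∈-─ (there x∈ys) (there y∈ys) x≢y = there (∈-─ x∈ys y∈ys x≢y)

Unique-⊆⇒length≤ : {xs ys : List A} → Unique xs → xs ⊆ ys → length xs ℕ.≤ length ys
Unique-⊆⇒length≤ {xs = []} _ _ = z≤n
Unique-⊆⇒length≤ {xs = x ∷ xs} {ys} (x∉xs ∷ uxs) xs⊆ys = begin
  suc (length xs)          ≤⟨ s≤s (Unique-⊆⇒length≤ uxs xs⊆ys─x) ⟩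
  suc (length (ys ─ x∈ys)) ≡⟨ sym (length-removeAt′ ys _) ⟩
  length ys                ∎
  where
  open ℕ.≤-Reasoning
  x∈ys : x ∈ ys
  x∈ys = xs⊆ys (here refl)
  xs⊆ys─x : xs ⊆ (ys ─ x∈ys)
  xs⊆ys─x y∈xs = ∈-─ x∈ys (xs⊆ys (there y∈xs)) (λ { refl → All.lookup x∉xs y∈xs refl })

indicator : Bool → ℕ
indicator b = if b then 1 else 0

indicator-∧ : ∀ a b → indicator (a ∧ b) ≡ indicator a ℕ.* indicator b
indicator-∧ true  b = sym (ℕ.+-identityʳ (indicator b))
indicator-∧ false b = refl

sum-map-+ : (f g : A → ℕ) (xs : List A) →
            sumℕ (map (λ x → f x ℕ.+ g x) xs) ≡ sumℕ (map f xs) ℕ.+ sumℕ (map g xs)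
sum-map-+ f g [] = refl
sum-map-+ f g (x ∷ xs) =
  trans (cong (f x ℕ.+ g x ℕ.+_) (sum-map-+ f g xs)) (+-interchange (f x) (g x) _ _)

sum-map-mono : {f g : A → ℕ} (xs : List A) → (∀ x → f x ℕ.≤ g x) →
               sumℕ (map f xs) ℕ.≤ sumℕ (map g xs)
sum-map-mono [] f≤g = z≤n
sum-map-mono (x ∷ xs) f≤g = ℕ.+-mono-≤ (f≤g x) (sum-map-mono xs f≤g)

sum-map-*ˡ : (k : ℕ) (f : A → ℕ) (xs : List A) →
             sumℕ (map (λ x → k ℕ.* f x) xs) ≡ k ℕ.* sumℕ (map f xs)
sum-map-*ˡ k f [] = sym (ℕ.*-zeroʳ k)
sum-map-*ˡ k f (x ∷ xs) =
  trans (cong (k ℕ.* f x ℕ.+_) (sum-map-*ˡ k f xs)) (sym (ℕ.*-distribˡ-+ k (f x) _))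

sum-product : (f : A → ℕ) (g : B → ℕ) (xs : List A) (ys : List B) →
              sumℕ (map (λ x → sumℕ (map (λ y → f x ℕ.* g y) ys)) xs) ≡
              sumℕ (map f xs) ℕ.* sumℕ (map g ys)
sum-product f g [] ys = refl
sum-product f g (x ∷ xs) ys =
  trans (cong₂ ℕ._+_ (sum-map-*ˡ (f x) g ys) (sum-product f g xs ys))
        (sym (ℕ.*-distribʳ-+ (sumℕ (map g ys)) (f x) _))

sum-concatMap : (f : B → ℕ) (g : A → List B) (xs : List A) →
                sumℕ (map f (concatMap g xs)) ≡ sumℕ (map (λ x → sumℕ (map f (g x))) xs)
sum-concatMap f g [] = refl
sum-concatMap f g (x ∷ xs) = begin
  sumℕ (map f (g x ++ concatMap g xs))
    ≡⟨ cong sumℕ (map-++ f (g x) _) ⟩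
  sumℕ (map f (g x) ++ map f (concatMap g xs))
    ≡⟨ sum-++ (map f (g x)) _ ⟩
  sumℕ (map f (g x)) ℕ.+ sumℕ (map f (concatMap g xs))
    ≡⟨ cong (sumℕ (map f (g x)) ℕ.+_) (sum-concatMap f g xs) ⟩
  sumℕ (map (λ x → sumℕ (map f (g x))) (x ∷ xs)) ∎
  where open ≡-Reasoning

sum-indicator≡length-filter : (f : A → Bool) (xs : List A) →
                              sumℕ (map (indicator ∘ f) xs) ≡ length (filter (T? ∘ f) xs)
sum-indicator≡length-filter f [] = refl
sum-indicator≡length-filter f (x ∷ xs) with f x
... | true  = cong suc (sum-indicator≡length-filter f xs)
... | false = sum-indicator≡length-filter f xs

count≤length : (f : A → Bool) {xs ys : List A} → Unique xs →
               (∀ {x} → x ∈ xs → T (f x) → x ∈ ys) →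
               sumℕ (map (indicator ∘ f) xs) ℕ.≤ length ys
count≤length f {xs = xs} {ys} uxs hits∈ys = begin
  sumℕ (map (indicator ∘ f) xs)  ≡⟨ sum-indicator≡length-filter f xs ⟩
  length (filter (T? ∘ f) xs)    ≤⟨ Unique-⊆⇒length≤ (Unique.filter⁺ (T? ∘ f) uxs) hits⊆ys ⟩
  length ys                      ∎
  where
  open ℕ.≤-Reasoning
  hits⊆ys : filter (T? ∘ f) xs ⊆ ys
  hits⊆ys x∈ = let (x∈xs , fx) = ∈-filter⁻ (T? ∘ f) x∈ in hits∈ys x∈xs fx

length-filter-pos≤sum : (f : A → ℕ) (xs : List A) →
                        length (filter (λ x → 1 ℕ.≤? f x) xs) ℕ.≤ sumℕ (map f xs)
length-filter-pos≤sum f [] = z≤n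
length-filter-pos≤sum f (x ∷ xs) with f x
... | zero  = length-filter-pos≤sum f xs
... | suc k = s≤s (ℕ.≤-trans (length-filter-pos≤sum f xs) (ℕ.m≤n+m _ k))

length≤sum : (f : A → ℕ) {xs ys : List A} → Unique xs → xs ⊆ ys →
             (∀ {x} → x ∈ xs → 1 ℕ.≤ f x) → length xs ℕ.≤ sumℕ (map f ys)
length≤sum f {ys = ys} uxs xs⊆ys pos =
  ℕ.≤-trans (Unique-⊆⇒length≤ uxs (λ x∈ → ∈-filter⁺ (λ x → 1 ℕ.≤? f x) (xs⊆ys x∈) (pos x∈)))
            (length-filter-pos≤sum f ys)

i+[j-i]≡j : ∀ i j → i ℤ.+ (j ℤ.- i) ≡ j
i+[j-i]≡j = solve-∀

i+j-j≡i : ∀ i j → i ℤ.+ j ℤ.- j ≡ i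
i+j-j≡i = solve-∀

i-j+j≡i : ∀ i j → i ℤ.- j ℤ.+ j ≡ i
i-j+j≡i = solve-∀

i-j+[j-k]≡i-k : ∀ i j k → i ℤ.- j ℤ.+ (j ℤ.- k) ≡ i ℤ.- k
i-j+[j-k]≡i-k = solve-∀

∣i-j∣≡0⇒i≡j : ∀ i j → ℤ.∣ i ℤ.- j ∣ ≡ 0 → i ≡ j
∣i-j∣≡0⇒i≡j i j h = ℤ.i-j≡0⇒i≡j i j (ℤ.∣i∣≡0⇒i≡0 h)

∣i-j∣≡1⇒ : ∀ i j → ℤ.∣ i ℤ.- j ∣ ≡ 1 → i ≡ j ℤ.+ + 1 ⊎ j ≡ i ℤ.+ + 1
∣i-j∣≡1⇒ i j h with ℤ.+∣i∣≡i⊎+∣i∣≡-i (i ℤ.- j)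
... | inj₁ e = inj₁ (trans (sym (i+[j-i]≡j j i)) (cong (ℤ._+_ j) (trans (sym e) (cong +_ h))))
... | inj₂ e = inj₂ (trans (j≡i-[i-j] i j) (cong (ℤ._+_ i) (trans (sym e) (cong +_ h))))
  where
  j≡i-[i-j] : ∀ i j → j ≡ i ℤ.+ ℤ.- (i ℤ.- j)
  j≡i-[i-j] = solve-∀

i≤+∣i∣ : ∀ i → i ℤ.≤ + ℤ.∣ i ∣
i≤+∣i∣ (+ n) = ℤ.≤-refl
i≤+∣i∣ -[1+ n ] = ℤ.-≤+

-i≤+∣i∣ : ∀ i → ℤ.- i ℤ.≤ + ℤ.∣ i ∣
-i≤+∣i∣ i = subst (ℤ.- i ℤ.≤_) (cong +_ (ℤ.∣-i∣≡∣i∣ i)) (i≤+∣i∣ (ℤ.- i))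

-∣i∣≤i : ∀ i → ℤ.- + ℤ.∣ i ∣ ℤ.≤ i
-∣i∣≤i i = subst (ℤ.- + ℤ.∣ i ∣ ℤ.≤_) (ℤ.neg-involutive i) (ℤ.neg-mono-≤ (-i≤+∣i∣ i))

-n≤i≤n⇒∣i∣≤n : ∀ {i n} → ℤ.- + n ℤ.≤ i → i ℤ.≤ + n → ℤ.∣ i ∣ ℕ.≤ n
-n≤i≤n⇒∣i∣≤n {i} {n} lo hi with ℤ.+∣i∣≡i⊎+∣i∣≡-i i
... | inj₁ e = ℤ.drop‿+≤+ (subst (ℤ._≤ + n) (sym e) hi)
... | inj₂ e = ℤ.drop‿+≤+ (subst₂ ℤ._≤_ (sym e) (ℤ.neg-involutive (+ n)) (ℤ.neg-mono-≤ lo))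

∣i∣≤n⇒-n≤i≤n : ∀ {i n} → ℤ.∣ i ∣ ℕ.≤ n → ℤ.- + n ℤ.≤ i × i ℤ.≤ + n
∣i∣≤n⇒-n≤i≤n {i} {n} h =
  ℤ.≤-trans (ℤ.neg-mono-≤ (+≤+ h)) (-∣i∣≤i i) , ℤ.≤-trans (i≤+∣i∣ i) (+≤+ h)

+-cancelʳ-≤ : ∀ {i j} k → i ℤ.+ k ℤ.≤ j ℤ.+ k → i ℤ.≤ j
+-cancelʳ-≤ {i} {j} k h = subst₂ ℤ._≤_ (i+j-j≡i i k) (i+j-j≡i j k) (ℤ.+-monoˡ-≤ (ℤ.- k) h)

<⇒+1≤ : ∀ {i j} → i ℤ.< j → i ℤ.+ + 1 ℤ.≤ j
<⇒+1≤ {i} {j} i<j = subst (ℤ._≤ j) (ℤ.+-comm (+ 1) i) (ℤ.i<j⇒suc[i]≤j i<j)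

<-+1⇒≤ : ∀ {i j} → i ℤ.< j ℤ.+ + 1 → i ℤ.≤ j
<-+1⇒≤ {i} {j} i<j+1 = +-cancelʳ-≤ (+ 1) (<⇒+1≤ i<j+1)

∣-i--j∣≡∣i-j∣ : ∀ i j → ℤ.∣ ℤ.- i ℤ.- ℤ.- j ∣ ≡ ℤ.∣ i ℤ.- j ∣
∣-i--j∣≡∣i-j∣ i j = trans (cong ℤ.∣_∣ (-i--j≡-[i-j] i j)) (ℤ.∣-i∣≡∣i∣ (i ℤ.- j))
  where
  -i--j≡-[i-j] : ∀ i j → ℤ.- i ℤ.- ℤ.- j ≡ ℤ.- (i ℤ.- j)
  -i--j≡-[i-j] = solve-∀

⊓+∣-∣≡⊔ : ∀ i j → i ℤ.⊓ j ℤ.+ + ℤ.∣ i ℤ.- j ∣ ≡ i ℤ.⊔ j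
⊓+∣-∣≡⊔ i j with ℤ.≤-total i j
... | inj₁ i≤j = begin
  i ℤ.⊓ j ℤ.+ + ℤ.∣ i ℤ.- j ∣  ≡⟨ cong₂ ℤ._+_ (ℤ.i≤j⇒i⊓j≡i i≤j) (cong +_ (ℤ.∣i-j∣≡∣j-i∣ i j)) ⟩
  i ℤ.+ + ℤ.∣ j ℤ.- i ∣        ≡⟨ cong (ℤ._+_ i) (ℤ.0≤i⇒+∣i∣≡i (ℤ.i≤j⇒0≤j-i i≤j)) ⟩
  i ℤ.+ (j ℤ.- i)              ≡⟨ i+[j-i]≡j i j ⟩
  j                            ≡⟨ sym (ℤ.i≤j⇒i⊔j≡j i≤j) ⟩
  i ℤ.⊔ j                      ∎
  where open ≡-Reasoning
... | inj₂ j≤i = begin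
  i ℤ.⊓ j ℤ.+ + ℤ.∣ i ℤ.- j ∣  ≡⟨ cong₂ ℤ._+_ (ℤ.i≥j⇒i⊓j≡j j≤i) (ℤ.0≤i⇒+∣i∣≡i (ℤ.i≤j⇒0≤j-i j≤i)) ⟩
  j ℤ.+ (i ℤ.- j)              ≡⟨ i+[j-i]≡j j i ⟩
  i                            ≡⟨ sym (ℤ.i≥j⇒i⊔j≡i j≤i) ⟩
  i ℤ.⊔ j                      ∎
  where open ≡-Reasoning

least : {P : ℕ → Set} → (∀ n → Dec (P n)) → ∀ k → P k →
        ∃ λ j → j ℕ.≤ k × P j × (∀ r → r ℕ.< j → ¬ P r)
least P? k pk with P? 0
... | yes p0 = 0 , z≤n , p0 , λ _ ()
least P? zero    pk | no ¬p0 = contradiction pk ¬p0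
least {P} P? (suc k) pk | no ¬p0 with least {P ∘ suc} (P? ∘ suc) k pk
... | j , j≤k , pj , below = suc j , s≤s j≤k , pj , λ where
  zero    _         → ¬p0
  (suc r) (s≤s r<j) → below r r<j

greatest : {P : ℕ → Set} → (∀ n → Dec (P n)) → P 0 → ∀ k →
           ∃ λ i → i ℕ.≤ k × P i × (∀ r → i ℕ.< r → r ℕ.≤ k → ¬ P r)
greatest P? p0 zero = 0 , z≤n , p0 , λ r 0<r r≤0 → ⊥-elim (ℕ.<⇒≱ 0<r r≤0)
greatest P? p0 (suc k) with P? (suc k)
... | yes pk = suc k , ℕ.≤-refl , pk , λ r k<r r≤k → ⊥-elim (ℕ.<⇒≱ k<r r≤k)
... | no ¬pk with greatest P? p0 k
...   | i , i≤k , pi , above = i , ℕ.m≤n⇒m≤1+n i≤k , pi , λ r i<r r≤1+k →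
  Sum.[ (λ r<1+k → above r i<r (ℕ.≤-pred r<1+k)) , (λ { refl → ¬pk }) ] (ℕ.m≤n⇒m<n∨m≡n r≤1+k)

crossing : (f : ℕ → ℤ) → (∀ n → f (suc n) ℤ.≤ f n ℤ.+ + 1) → ∀ {t₀ t₁ k} →
  f 0 ℤ.≤ t₀ → t₀ ℤ.≤ t₁ → t₁ ℤ.≤ f k →
  ∃ λ i → ∃ λ l → f i ≡ t₀ × f (i ℕ.+ l) ≡ t₁ ×
    (∀ r → r ℕ.≤ l → t₀ ℤ.≤ f (i ℕ.+ r) × f (i ℕ.+ r) ℤ.≤ t₁)
crossing f f-step {t₀} {t₁} {k} f0≤t₀ t₀≤t₁ t₁≤fk
  with least (λ n → t₁ ℤ.≤? f n) k t₁≤fk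
... | j , _ , t₁≤fj , not-high with greatest (λ n → f n ℤ.≤? t₀) f0≤t₀ j
... | i , i≤j , fi≤t₀ , not-low =
  i , j ℕ.∸ i , ℤ.≤-antisym fi≤t₀ t₀≤fi , trans (cong f i+l≡j) (ℤ.≤-antisym fj≤t₁ t₁≤fj) , band
  where
  below : ∀ r → r ℕ.< j → f r ℤ.< t₁
  below r r<j = ℤ.≰⇒> (not-high r r<j)
  above : ∀ r → i ℕ.< r → r ℕ.≤ j → t₀ ℤ.< f r
  above r i<r r≤j = ℤ.≰⇒> (not-low r i<r r≤j)
  i+l≡j : i ℕ.+ (j ℕ.∸ i) ≡ j
  i+l≡j = ℕ.m+[n∸m]≡n i≤j
  first-at-most : ∀ m → (∀ r → r ℕ.< m → f r ℤ.< t₁) → f m ℤ.≤ t₁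
  first-at-most zero    _     = ℤ.≤-trans f0≤t₀ t₀≤t₁
  first-at-most (suc m) below = ℤ.≤-trans (f-step m) (<⇒+1≤ (below m (ℕ.n<1+n m)))
  fj≤t₁ : f j ℤ.≤ t₁
  fj≤t₁ = first-at-most j below
  t₀≤fi : t₀ ℤ.≤ f i
  t₀≤fi with ℕ.m≤n⇒m<n∨m≡n i≤j
  ... | inj₁ i<j = <-+1⇒≤ (ℤ.<-≤-trans (above (suc i) (ℕ.n<1+n i) i<j) (f-step i))
  ... | inj₂ i≡j = subst (λ m → t₀ ℤ.≤ f m) (sym i≡j) (ℤ.≤-trans t₀≤t₁ t₁≤fj)
  band : ∀ r → r ℕ.≤ j ℕ.∸ i → t₀ ℤ.≤ f (i ℕ.+ r) × f (i ℕ.+ r) ℤ.≤ t₁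
  band r r≤l = lower r i+r≤j , upper
    where
    i+r≤j : i ℕ.+ r ℕ.≤ j
    i+r≤j = subst (i ℕ.+ r ℕ.≤_) i+l≡j (ℕ.+-monoʳ-≤ i r≤l)
    lower : ∀ r → i ℕ.+ r ℕ.≤ j → t₀ ℤ.≤ f (i ℕ.+ r)
    lower zero    _     = subst (λ m → t₀ ℤ.≤ f m) (sym (ℕ.+-identityʳ i)) t₀≤fi
    lower (suc r) i+r≤j = ℤ.<⇒≤ (above (i ℕ.+ suc r) (ℕ.m<m+n i (s≤s z≤n)) i+r≤j)
    upper : f (i ℕ.+ r) ℤ.≤ t₁
    upper with ℕ.m≤n⇒m<n∨m≡n i+r≤j
    ... | inj₁ i+r<j = ℤ.<⇒≤ (below (i ℕ.+ r) i+r<j)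
    ... | inj₂ i+r≡j = subst (λ m → f m ℤ.≤ t₁) (sym i+r≡j) fj≤t₁

Adj-sym : ∀ {x y} → Adj x y → Adj y x
Adj-sym {x₁ , x₂} {y₁ , y₂} = subst (_≡ 1) (cong₂ ℕ._+_ (ℤ.∣i-j∣≡∣j-i∣ x₁ y₁) (ℤ.∣i-j∣≡∣j-i∣ x₂ y₂))

Adj-cases : ∀ x y → Adj x y → y ≡ right x ⊎ x ≡ right y ⊎ y ≡ up x ⊎ x ≡ up y
Adj-cases (x₁ , x₂) (y₁ , y₂) h with ℤ.∣ x₁ ℤ.- y₁ ∣ in e₁ | ℤ.∣ x₂ ℤ.- y₂ ∣ in e₂
Adj-cases (x₁ , x₂) (y₁ , y₂) refl | 0 | 1
  with refl ← ∣i-j∣≡0⇒i≡j x₁ y₁ e₁ | ∣i-j∣≡1⇒ x₂ y₂ e₂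
... | inj₁ refl = inj₂ (inj₂ (inj₂ refl))
... | inj₂ refl = inj₂ (inj₂ (inj₁ refl))
Adj-cases (x₁ , x₂) (y₁ , y₂) refl | 1 | 0
  with refl ← ∣i-j∣≡0⇒i≡j x₂ y₂ e₂ | ∣i-j∣≡1⇒ x₁ y₁ e₁
... | inj₁ refl = inj₂ (inj₁ refl)
... | inj₂ refl = inj₁ refl

i-[i+1]≡-1 : ∀ i → i ℤ.- (i ℤ.+ + 1) ≡ -[1+ 0 ]
i-[i+1]≡-1 = solve-∀

Adj-right : ∀ z → Adj z (right z)
Adj-right (i , j) rewrite i-[i+1]≡-1 i | ℤ.+-inverseʳ j = refl

left down : Pt → Pt
left (i , j) = (i ℤ.- + 1 , j)
down (i , j) = (i , j ℤ.- + 1)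

i-[i-1]≡1 : ∀ i → i ℤ.- (i ℤ.- + 1) ≡ + 1
i-[i-1]≡1 = solve-∀

right-left : ∀ z → right (left z) ≡ z
right-left (i , j) = cong (_, j) (i-j+j≡i i (+ 1))

up-down : ∀ z → up (down z) ≡ z
up-down (i , j) = cong (i ,_) (i-j+j≡i j (+ 1))

left-right : ∀ z → left (right z) ≡ z
left-right (i , j) = cong (_, j) (i+j-j≡i i (+ 1))

down-up : ∀ z → down (up z) ≡ z
down-up (i , j) = cong (i ,_) (i+j-j≡i j (+ 1))

Adj-left : ∀ z → Adj z (left z)
Adj-left (i , j) rewrite i-[i-1]≡1 i | ℤ.+-inverseʳ j = refl

Adj-down : ∀ z → Adj z (down z)
Adj-down (i , j) rewrite ℤ.+-inverseʳ i | i-[i-1]≡1 j = refl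

Adj-up : ∀ z → Adj z (up z)
Adj-up (i , j) rewrite ℤ.+-inverseʳ i | i-[i+1]≡-1 j = refl

range-Unique : ∀ N → Unique (range N)
range-Unique N = Unique.map⁺ (λ e → ℤ.+-injective (-k-injective e)) (Unique.upTo⁺ _)
  where
  -k-injective : ∀ {i j} → i ℤ.- + suc N ≡ j ℤ.- + suc N → i ≡ j
  -k-injective {i} {j} e =
    trans (sym (i-j+j≡i i (+ suc N))) (trans (cong (ℤ._+ + suc N) e) (i-j+j≡i j (+ suc N)))

∈-range : ∀ N {x} → ℤ.- + suc N ℤ.≤ x → x ℤ.≤ + N → x ∈ range N
∈-range N {x} lo hi = subst (_∈ range N) k-[1+N]≡x (∈-map⁺ _ (∈-upTo⁺ k<))
  where
  k : ℕ
  k = ℤ.∣ x ℤ.+ + suc N ∣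
  +k≡ : + k ≡ x ℤ.+ + suc N
  +k≡ = ℤ.0≤i⇒+∣i∣≡i (subst (ℤ._≤ x ℤ.+ + suc N) (ℤ.+-inverseˡ (+ suc N)) (ℤ.+-monoˡ-≤ (+ suc N) lo))
  k-[1+N]≡x : + k ℤ.- + suc N ≡ x
  k-[1+N]≡x = trans (cong (ℤ._- + suc N) +k≡) (i+j-j≡i x (+ suc N))
  k< : k ℕ.< suc (suc (N ℕ.+ N))
  k< = s≤s (ℤ.drop‿+≤+ (begin
    + k               ≡⟨ +k≡ ⟩
    x ℤ.+ + suc N     ≤⟨ ℤ.+-monoˡ-≤ (+ suc N) hi ⟩
    + N ℤ.+ + suc N   ≡⟨ cong +_ (ℕ.+-suc N N) ⟩
    + suc (N ℕ.+ N)   ∎))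
    where open ℤ.≤-Reasoning

∣∣≤⇒∈-range : ∀ N {x} → ℤ.∣ x ∣ ℕ.≤ N → x ∈ range N
∣∣≤⇒∈-range N ∣x∣≤N = let (lo , hi) = ∣i∣≤n⇒-n≤i≤n ∣x∣≤N in
  ∈-range N (ℤ.≤-trans (ℤ.neg-mono-≤ (+≤+ (ℕ.n≤1+n N))) lo) hi

∣∣≤⇒pred∈-range : ∀ N {x} → ℤ.∣ x ∣ ℕ.≤ N → x ℤ.- + 1 ∈ range N
∣∣≤⇒pred∈-range N {x} ∣x∣≤N = let (lo , hi) = ∣i∣≤n⇒-n≤i≤n {x} ∣x∣≤N in
  ∈-range N (subst (ℤ._≤ x ℤ.- + 1) (-n-1≡-[1+n] N) (ℤ.+-monoˡ-≤ (ℤ.- + 1) lo)) (ℤ.i≤j⇒i-k≤j (+ 1) hi)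
  where
  -n-1≡-[1+n] : ∀ n → ℤ.- + n ℤ.- + 1 ≡ ℤ.- + suc n
  -n-1≡-[1+n] n = trans (-i-j≡-[j+i] (+ n) (+ 1)) (cong ℤ.-_ (sym (ℤ.pos-+ 1 n)))
    where
    -i-j≡-[j+i] : ∀ i j → ℤ.- i ℤ.- j ≡ ℤ.- (j ℤ.+ i)
    -i-j≡-[j+i] = solve-∀

sum-box : ∀ N (f : Pt → ℕ) →
          sumℕ (map f (box N)) ≡ sumℕ (map (λ i → sumℕ (map (λ j → f (i , j)) (range N))) (range N))
sum-box N f =
  trans (sum-concatMap f (λ i → map (i ,_) (range N)) (range N))
        (cong sumℕ (map-cong (λ i → cong sumℕ (sym (map-∘ {g = f} {f = i ,_} (range N)))) (range N)))

∈-box : ∀ N {i j} → i ∈ range N → j ∈ range N → (i , j) ∈ box N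
∈-box N {i} i∈ j∈ =
  ∈-concatMap⁺ (λ i → map (i ,_) (range N)) (Any.map (λ { refl → ∈-map⁺ (i ,_) j∈ }) i∈)

row : Pt → ℤ
row = proj₂

Adj⇒row-step : ∀ x y → Adj x y → row y ℤ.≤ row x ℤ.+ + 1
Adj⇒row-step (x₁ , x₂) (y₁ , y₂) adj = begin
  y₂                   ≡⟨ sym (i+[j-i]≡j x₂ y₂) ⟩
  x₂ ℤ.+ (y₂ ℤ.- x₂)   ≤⟨ ℤ.+-monoʳ-≤ x₂ (ℤ.≤-trans (i≤+∣i∣ (y₂ ℤ.- x₂)) (+≤+ ∣y₂-x₂∣≤1)) ⟩
  x₂ ℤ.+ + 1           ∎
  where
  open ℤ.≤-Reasoning
  ∣y₂-x₂∣≤1 : ℤ.∣ y₂ ℤ.- x₂ ∣ ℕ.≤ 1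
  ∣y₂-x₂∣≤1 = subst₂ ℕ._≤_ (ℤ.∣i-j∣≡∣j-i∣ x₂ y₂) adj (ℕ.m≤n+m _ ℤ.∣ x₁ ℤ.- y₁ ∣)

taxicab : Pt → Pt → ℕ
taxicab (x₁ , x₂) (y₁ , y₂) = ℤ.∣ x₁ ℤ.- y₁ ∣ ℕ.+ ℤ.∣ x₂ ℤ.- y₂ ∣

taxicab-triangle : ∀ x y z → taxicab x z ℕ.≤ taxicab x y ℕ.+ taxicab y z
taxicab-triangle (x₁ , x₂) (y₁ , y₂) (z₁ , z₂) = ℕ.≤-trans
  (ℕ.+-mono-≤ (∣i-k∣≤∣i-j∣+∣j-k∣ x₁ y₁ z₁) (∣i-k∣≤∣i-j∣+∣j-k∣ x₂ y₂ z₂))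
  (ℕ.≤-reflexive (+-interchange ℤ.∣ x₁ ℤ.- y₁ ∣ ℤ.∣ y₁ ℤ.- z₁ ∣ ℤ.∣ x₂ ℤ.- y₂ ∣ ℤ.∣ y₂ ℤ.- z₂ ∣))
  where
  ∣i-k∣≤∣i-j∣+∣j-k∣ : ∀ i j k → ℤ.∣ i ℤ.- k ∣ ℕ.≤ ℤ.∣ i ℤ.- j ∣ ℕ.+ ℤ.∣ j ℤ.- k ∣
  ∣i-k∣≤∣i-j∣+∣j-k∣ i j k = subst (λ d → ℤ.∣ d ∣ ℕ.≤ ℤ.∣ i ℤ.- j ∣ ℕ.+ ℤ.∣ j ℤ.- k ∣) (i-j+[j-k]≡i-k i j k)
    (ℤ.∣i+j∣≤∣i∣+∣j∣ (i ℤ.- j) (j ℤ.- k))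

taxicab-self : ∀ x → taxicab x x ≡ 0
taxicab-self (x₁ , x₂) rewrite ℤ.+-inverseʳ x₁ | ℤ.+-inverseʳ x₂ = refl

record Rect : Set where
  constructor rect
  field
    x₀ y₀        : ℤ
    width height : ℕ
open Rect

InInterval : ℤ → ℕ → ℤ → Set
InInterval lo len x = lo ℤ.≤ x × x ℤ.≤ lo ℤ.+ + len

InInterval? : ∀ lo len x → Dec (InInterval lo len x)
InInterval? lo len x = lo ℤ.≤? x ×-dec x ℤ.≤? lo ℤ.+ + len

InRect : Rect → Pt → Set
InRect R (x , y) = InInterval (x₀ R) (width R) x × InInterval (y₀ R) (height R) y

InRect? : ∀ R z → Dec (InRect R z)
InRect? R (x , y) = InInterval? (x₀ R) (width R) x ×-dec InInterval? (y₀ R) (height R) y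

T-does⇒ : (a? : Dec A) → T (does a?) → A
T-does⇒ (yes a) _ = a

T-does⇐ : (a? : Dec A) → A → T (does a?)
T-does⇐ (yes _) _ = _
T-does⇐ (no ¬a) a = ¬a a

intervalᵇ : ℤ → ℕ → ℤ → Bool
intervalᵇ lo len x = does (InInterval? lo len x)

rectᵇ : Rect → Subset
rectᵇ R z = does (InRect? R z)

InInterval⇒∣∣≤ : ∀ {lo len x} → InInterval lo len x → ℤ.∣ x ∣ ℕ.≤ ℤ.∣ lo ∣ ℕ.+ len
InInterval⇒∣∣≤ {lo} {len} {x} (lo≤x , x≤hi) = -n≤i≤n⇒∣i∣≤n
  (begin
    ℤ.- + (ℤ.∣ lo ∣ ℕ.+ len)   ≤⟨ ℤ.neg-mono-≤ (+≤+ (ℕ.m≤m+n _ len)) ⟩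
    ℤ.- + ℤ.∣ lo ∣             ≤⟨ -∣i∣≤i lo ⟩
    lo                         ≤⟨ lo≤x ⟩
    x                          ∎)
  (begin
    x                          ≤⟨ x≤hi ⟩
    lo ℤ.+ + len               ≤⟨ ℤ.+-monoˡ-≤ (+ len) (i≤+∣i∣ lo) ⟩
    + ℤ.∣ lo ∣ ℤ.+ + len       ≡⟨ sym (ℤ.pos-+ _ len) ⟩
    + (ℤ.∣ lo ∣ ℕ.+ len)       ∎)
  where open ℤ.≤-Reasoning

interval-points : ℤ → ℕ → List ℤ
interval-points lo len = map (λ k → lo ℤ.+ + k) (upTo (suc len))

∈-interval-points : ∀ {lo len x} → InInterval lo len x → x ∈ interval-points lo len
∈-interval-points {lo} {len} {x} (lo≤x , x≤lo+len) =
  subst (_∈ interval-points lo len) lo+k≡x (∈-map⁺ _ (∈-upTo⁺ (s≤s k≤len)))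
  where
  k : ℕ
  k = ℤ.∣ x ℤ.- lo ∣
  +k≡x-lo : + k ≡ x ℤ.- lo
  +k≡x-lo = ℤ.0≤i⇒+∣i∣≡i (ℤ.i≤j⇒0≤j-i lo≤x)
  lo+k≡x : lo ℤ.+ + k ≡ x
  lo+k≡x = trans (cong (ℤ._+_ lo) +k≡x-lo) (i+[j-i]≡j lo x)
  k≤len : k ℕ.≤ len
  k≤len = ℤ.drop‿+≤+ (begin
    + k                   ≡⟨ +k≡x-lo ⟩
    x ℤ.- lo              ≤⟨ ℤ.+-monoˡ-≤ (ℤ.- lo) x≤lo+len ⟩
    lo ℤ.+ + len ℤ.- lo   ≡⟨ i+j-i≡j lo (+ len) ⟩
    + len                 ∎)
    where
    open ℤ.≤-Reasoning
    i+j-i≡j : ∀ i j → i ℤ.+ j ℤ.- i ≡ j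
    i+j-i≡j = solve-∀

count-interval : ∀ N lo len → sumℕ (map (indicator ∘ intervalᵇ lo len) (range N)) ℕ.≤ suc len
count-interval N lo len =
  subst (sumℕ (map (indicator ∘ intervalᵇ lo len) (range N)) ℕ.≤_)
    (trans (length-map _ (upTo (suc len))) (length-upTo (suc len)))
    (count≤length (intervalᵇ lo len) (range-Unique N)
      (λ {x} _ x∈ → ∈-interval-points (T-does⇒ (InInterval? lo len x) x∈)))

T-xor⇒ : ∀ a b → T (a xor b) → (T a × ¬ T b) ⊎ (¬ T a × T b)
T-xor⇒ true  false _ = inj₁ (_ , λ ())
T-xor⇒ false true  _ = inj₂ ((λ ()) , _)

interval-boundary : ∀ {lo len x} → T (intervalᵇ lo len x xor intervalᵇ lo len (x ℤ.+ + 1)) →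
                    x ∈ (lo ℤ.- + 1) ∷ (lo ℤ.+ + len) ∷ []
interval-boundary {lo} {len} {x} h with T-xor⇒ (intervalᵇ lo len x) _ h
... | inj₁ (x∈ , x+1∉) =
  there (here (ℤ.≤-antisym x≤lo+len (<-+1⇒≤ (ℤ.≰⇒> λ x+1≤lo+len →
    x+1∉ (T-does⇐ (InInterval? lo len (x ℤ.+ + 1)) (lo≤x+1 , x+1≤lo+len))))))
  where
  lo≤x : lo ℤ.≤ x
  lo≤x = proj₁ (T-does⇒ (InInterval? lo len x) x∈)
  x≤lo+len : x ℤ.≤ lo ℤ.+ + len
  x≤lo+len = proj₂ (T-does⇒ (InInterval? lo len x) x∈)
  lo≤x+1 : lo ℤ.≤ x ℤ.+ + 1
  lo≤x+1 = ℤ.≤-trans lo≤x (ℤ.i≤i+j x (+ 1))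
... | inj₂ (x∉ , x+1∈) = here (trans (sym (i+j-j≡i x (+ 1))) (cong (ℤ._- + 1) x+1≡lo))
  where
  lo≤x+1 : lo ℤ.≤ x ℤ.+ + 1
  lo≤x+1 = proj₁ (T-does⇒ (InInterval? lo len (x ℤ.+ + 1)) x+1∈)
  x+1≤lo+len : x ℤ.+ + 1 ℤ.≤ lo ℤ.+ + len
  x+1≤lo+len = proj₂ (T-does⇒ (InInterval? lo len (x ℤ.+ + 1)) x+1∈)
  x<lo : x ℤ.< lo
  x<lo = ℤ.≰⇒> λ lo≤x →
    x∉ (T-does⇐ (InInterval? lo len x) (lo≤x , ℤ.≤-trans (ℤ.i≤i+j x (+ 1)) x+1≤lo+len))
  x+1≡lo : x ℤ.+ + 1 ≡ lo
  x+1≡lo = ℤ.≤-antisym (<⇒+1≤ x<lo) lo≤x+1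

count-interval-boundary : ∀ N lo len →
  sumℕ (map (λ x → indicator (intervalᵇ lo len x xor intervalᵇ lo len (x ℤ.+ + 1))) (range N)) ℕ.≤ 2
count-interval-boundary N lo len =
  count≤length (λ x → intervalᵇ lo len x xor intervalᵇ lo len (x ℤ.+ + 1)) (range-Unique N)
    (λ _ → interval-boundary {lo} {len})

rectᵇ⇒InRect : ∀ R z → rectᵇ R z ≡ true → InRect R z
rectᵇ⇒InRect R z h = T-does⇒ (InRect? R z) (Equivalence.from T-≡ h)

InRect⇒rectᵇ : ∀ R z → InRect R z → rectᵇ R z ≡ true
InRect⇒rectᵇ R z = dec-true (InRect? R z)

rect-bound : Rect → ℕ
rect-bound R = (ℤ.∣ x₀ R ∣ ℕ.+ width R) ℕ.+ (ℤ.∣ y₀ R ∣ ℕ.+ height R)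

InRect⇒∣∣≤ : ∀ R {x y} → InRect R (x , y) → ℤ.∣ x ∣ ℕ.≤ rect-bound R × ℤ.∣ y ∣ ℕ.≤ rect-bound R
InRect⇒∣∣≤ R (x∈ , y∈) = ℕ.≤-trans (InInterval⇒∣∣≤ x∈) (ℕ.m≤m+n _ (ℤ.∣ y₀ R ∣ ℕ.+ height R)) ,
                         ℕ.≤-trans (InInterval⇒∣∣≤ y∈) (ℕ.m≤n+m _ (ℤ.∣ x₀ R ∣ ℕ.+ width R))

rect-finite : Rect → FinSubset
rect-finite R = record
  { mem     = rectᵇ R
  ; bound   = rect-bound R
  ; bounded = λ z h → InRect⇒∣∣≤ R (rectᵇ⇒InRect R z h)
  }

-- An isoperimetric bound for minimal sets

RectangleBound : (Pt → Set) → Set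
RectangleBound Good = ∀ R (zs : List Pt) → Unique zs → All (λ z → Good z × InRect R z) zs →
                      length zs ℕ.≤ 2 ℕ.+ (width R ℕ.+ height R)

∨-≡-trueˡ : ∀ {a} b → a ≡ true → a ∨ b ≡ true
∨-≡-trueˡ b refl = refl

∨-≡-trueʳ : ∀ a {b} → b ≡ true → a ∨ b ≡ true
∨-≡-trueʳ a refl = ∨-zeroʳ a

∧-≡-true : ∀ {a b} → a ∧ b ≡ true → a ≡ true × b ≡ true
∧-≡-true {true} {true} _ = refl , refl

-- An edge with endpoints in R (r₁, r₂), in M (m₁, m₂) and next to R (a₁, a₂) is a boundary edge
-- of at most one of the competitors filled and emptied below, and only if it leaves R.
fill-empty-split : ∀ r₁ r₂ m₁ m₂ a₁ a₂ → (r₁ ≡ true → a₂ ≡ true) → (r₂ ≡ true → a₁ ≡ true) →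
  indicator ((r₁ ∨ r₂) ∧ ((r₁ ∨ m₁ ∧ a₁) xor (r₂ ∨ m₂ ∧ a₂))) ℕ.+
  indicator ((r₁ ∨ r₂) ∧ ((not r₁ ∧ m₁ ∧ a₁) xor (not r₂ ∧ m₂ ∧ a₂))) ℕ.≤ indicator (r₁ xor r₂)
fill-empty-split true  true  _ _ _ _ _ _ = z≤n
fill-empty-split false false _ _ _ _ _ _ = z≤n
fill-empty-split true  false _ m₂ _ _ a₂ _ rewrite a₂ refl with m₂
... | true  = ℕ.≤-refl
... | false = ℕ.≤-refl
fill-empty-split false true m₁ _ _ _ _ a₁ rewrite a₁ refl with m₁
... | true  = ℕ.≤-refl
... | false = ℕ.≤-refl

data Dir : Set where
  horizontal vertical : Dir

move : Dir → Pt → Pt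
move horizontal = right
move vertical   = up

module IsoperimetricBound (M : Subset) (R : Rect) where

  U : FinSubset
  U = rect-finite R

  N : ℕ
  N = rect-bound R

  inR : Subset
  inR = rectᵇ R

  nearR : Subset
  nearR z = inR (right z) ∨ inR (left z) ∨ inR (up z) ∨ inR (down z)

  nearR-intro : ∀ {z w} → Adj z w → inR w ≡ true → nearR z ≡ true
  nearR-intro {z} {w} adj w∈R with Adj-cases z w adj
  ... | inj₁ refl = ∨-≡-trueˡ _ w∈R
  ... | inj₂ (inj₁ refl) =
    ∨-≡-trueʳ (inR (right z)) (∨-≡-trueˡ _ (trans (cong inR (left-right w)) w∈R))
  ... | inj₂ (inj₂ (inj₁ refl)) = ∨-≡-trueʳ (inR (right z)) (∨-≡-trueʳ (inR (left z)) (∨-≡-trueˡ _ w∈R))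
  ... | inj₂ (inj₂ (inj₂ refl)) =
    ∨-≡-trueʳ (inR (right z)) (∨-≡-trueʳ (inR (left z)) (∨-≡-trueʳ (inR (up z))
      (trans (cong inR (down-up w)) w∈R)))

  nearR-elim : ∀ z → nearR z ≡ true → ∃ λ w → inR w ≡ true × Adj z w
  nearR-elim z h with inR (right z) in e₁ | inR (left z) in e₂ | inR (up z) in e₃
  ... | true  | _     | _     = right z , e₁ , Adj-right z
  ... | false | true  | _     = left z , e₂ , Adj-left z
  ... | false | false | true  = up z , e₃ , Adj-up z
  ... | false | false | false = down z , h , Adj-down z

  filled emptied : Subset
  filled z  = inR z ∨ M z ∧ nearR z
  emptied z = not (inR z) ∧ M z ∧ nearR z

  filled-⊆ : ∀ z → filled z ≡ true → InClosure inR z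
  filled-⊆ z h with inR z
  ... | true  = inj₁ refl
  ... | false = inj₂ (refl , nearR-elim z (proj₂ (∧-≡-true h)))

  emptied-⊆ : ∀ z → emptied z ≡ true → InClosure inR z
  emptied-⊆ z h with inR z
  ... | false = inj₂ (refl , nearR-elim z (proj₂ (∧-≡-true {M z} (proj₂ (∧-≡-true {true} h)))))

  filled-τ : ∀ z → InTau inR z → filled z ≡ M z
  filled-τ z (z∉R , w , w∈R , adj) =
    trans (cong₂ (λ r n → r ∨ M z ∧ n) z∉R (nearR-intro adj w∈R)) (∧-identityʳ (M z))

  emptied-τ : ∀ z → InTau inR z → emptied z ≡ M z
  emptied-τ z (z∉R , w , w∈R , adj) =
    trans (cong₂ (λ r n → not r ∧ M z ∧ n) z∉R (nearR-intro adj w∈R)) (∧-identityʳ (M z))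

  edge-split : ∀ x d →
    countEdge U filled x (move d) ℕ.+ countEdge U emptied x (move d) ℕ.≤
    indicator (inR x xor inR (move d x))
  edge-split x d = fill-empty-split (inR x) (inR (move d x)) (M x) (M (move d x)) (nearR x) (nearR (move d x))
    (nearR-intro (Adj-sym {x} (Adj-move d x))) (nearR-intro (Adj-move d x))
    where
    Adj-move : ∀ d z → Adj z (move d z)
    Adj-move horizontal = Adj-right
    Adj-move vertical   = Adj-up

  crossings-horizontal : sumℕ (map (λ x → indicator (inR x xor inR (right x))) (box N)) ℕ.≤ 2 ℕ.* suc (height R)
  crossings-horizontal = begin
    sumℕ (map (λ x → indicator (inR x xor inR (right x))) (box N))
      ≡⟨ sum-box N (λ x → indicator (inR x xor inR (right x))) ⟩
    sumℕ (map (λ i → sumℕ (map (λ j → indicator ((X i ∧ Y j) xor (X (i ℤ.+ + 1) ∧ Y j))) L)) L)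
      ≡⟨ cong sumℕ (map-cong (λ i → cong sumℕ (map-cong (λ j →
           trans (cong indicator (sym (∧-distribʳ-xor (Y j) (X i) (X (i ℤ.+ + 1)))))
                 (indicator-∧ (X i xor X (i ℤ.+ + 1)) (Y j))) L)) L) ⟩
    sumℕ (map (λ i → sumℕ (map (λ j → indicator (X i xor X (i ℤ.+ + 1)) ℕ.* indicator (Y j)) L)) L)
      ≡⟨ sum-product (λ i → indicator (X i xor X (i ℤ.+ + 1))) (indicator ∘ Y) L L ⟩
    sumℕ (map (λ i → indicator (X i xor X (i ℤ.+ + 1))) L) ℕ.* sumℕ (map (indicator ∘ Y) L)
      ≤⟨ ℕ.*-mono-≤ (count-interval-boundary N (x₀ R) (width R)) (count-interval N (y₀ R) (height R)) ⟩
    2 ℕ.* suc (height R) ∎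
    where
    open ℕ.≤-Reasoning
    L : List ℤ
    L = range N
    X Y : ℤ → Bool
    X = intervalᵇ (x₀ R) (width R)
    Y = intervalᵇ (y₀ R) (height R)

  crossings-vertical : sumℕ (map (λ x → indicator (inR x xor inR (up x))) (box N)) ℕ.≤ suc (width R) ℕ.* 2
  crossings-vertical = begin
    sumℕ (map (λ x → indicator (inR x xor inR (up x))) (box N))
      ≡⟨ sum-box N (λ x → indicator (inR x xor inR (up x))) ⟩
    sumℕ (map (λ i → sumℕ (map (λ j → indicator ((X i ∧ Y j) xor (X i ∧ Y (j ℤ.+ + 1)))) L)) L)
      ≡⟨ cong sumℕ (map-cong (λ i → cong sumℕ (map-cong (λ j →
           trans (cong indicator (sym (∧-distribˡ-xor (X i) (Y j) (Y (j ℤ.+ + 1)))))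
                 (indicator-∧ (X i) (Y j xor Y (j ℤ.+ + 1)))) L)) L) ⟩
    sumℕ (map (λ i → sumℕ (map (λ j → indicator (X i) ℕ.* indicator (Y j xor Y (j ℤ.+ + 1))) L)) L)
      ≡⟨ sum-product (indicator ∘ X) (λ j → indicator (Y j xor Y (j ℤ.+ + 1))) L L ⟩
    sumℕ (map (indicator ∘ X) L) ℕ.* sumℕ (map (λ j → indicator (Y j xor Y (j ℤ.+ + 1))) L)
      ≤⟨ ℕ.*-mono-≤ (count-interval N (x₀ R) (width R)) (count-interval-boundary N (y₀ R) (height R)) ⟩
    suc (width R) ℕ.* 2 ∎
    where
    open ℕ.≤-Reasoning
    L : List ℤ
    L = range N
    X Y : ℤ → Bool
    X = intervalᵇ (x₀ R) (width R)
    Y = intervalᵇ (y₀ R) (height R)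

  perimeter : boundaryCount U filled ℕ.+ boundaryCount U emptied ℕ.≤ 2 ℕ.* (2 ℕ.+ (width R ℕ.+ height R))
  perimeter = begin
    boundaryCount U filled ℕ.+ boundaryCount U emptied
      ≡⟨ sym (sum-map-+ (λ x → count filled x horizontal ℕ.+ count filled x vertical)
                        (λ x → count emptied x horizontal ℕ.+ count emptied x vertical) (box N)) ⟩
    sumℕ (map (λ x → (count filled x horizontal ℕ.+ count filled x vertical) ℕ.+
                     (count emptied x horizontal ℕ.+ count emptied x vertical)) (box N))
      ≤⟨ sum-map-mono (box N) (λ x → ℕ.≤-trans
           (ℕ.≤-reflexive (+-interchange (count filled x horizontal) _ _ _))
           (ℕ.+-mono-≤ (edge-split x horizontal) (edge-split x vertical))) ⟩
    sumℕ (map (λ x → indicator (inR x xor inR (right x)) ℕ.+ indicator (inR x xor inR (up x))) (box N))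
      ≡⟨ sum-map-+ (λ x → indicator (inR x xor inR (right x))) (λ x → indicator (inR x xor inR (up x))) (box N) ⟩
    sumℕ (map (λ x → indicator (inR x xor inR (right x))) (box N)) ℕ.+
    sumℕ (map (λ x → indicator (inR x xor inR (up x))) (box N))
      ≤⟨ ℕ.+-mono-≤ crossings-horizontal crossings-vertical ⟩
    2 ℕ.* suc (height R) ℕ.+ suc (width R) ℕ.* 2
      ≡⟨ perimeter-formula (width R) (height R) ⟩
    2 ℕ.* (2 ℕ.+ (width R ℕ.+ height R)) ∎
    where
    open ℕ.≤-Reasoning
    count : Subset → Pt → Dir → ℕ
    count K x d = countEdge U K x (move d)
    perimeter-formula : ∀ w h → 2 ℕ.* suc h ℕ.+ suc w ℕ.* 2 ≡ 2 ℕ.* (2 ℕ.+ (w ℕ.+ h))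
    perimeter-formula = ℕ-solve-∀

  edges : List (Pt × Dir)
  edges = concatMap (λ x → (x , horizontal) ∷ (x , vertical) ∷ []) (box N)

  ∈-edges : ∀ {x} d → x ∈ box N → (x , d) ∈ edges
  ∈-edges {x} d x∈ =
    ∈-concatMap⁺ (λ x → (x , horizontal) ∷ (x , vertical) ∷ []) (Any.map (λ { refl → here-d d }) x∈)
    where
    here-d : ∀ d → (x , d) ∈ (x , horizontal) ∷ (x , vertical) ∷ []
    here-d horizontal = here refl
    here-d vertical   = there (here refl)

  crossesM : Pt × Dir → ℕ
  crossesM (x , d) = countEdge U M x (move d)

  boundaryCount-edges : boundaryCount U M ≡ sumℕ (map crossesM edges)
  boundaryCount-edges = sym (trans
    (sum-concatMap crossesM (λ x → (x , horizontal) ∷ (x , vertical) ∷ []) (box N))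
    (cong sumℕ (map-cong (λ x → cong (crossesM (x , horizontal) ℕ.+_) (ℕ.+-identityʳ _)) (box N))))

  endpoint-in-M : Pt × Dir → Pt
  endpoint-in-M (x , d) = if M x then x else move d x

  crossing-edge : ∀ {z} x d → M z ≡ true → inR z ≡ true →
    (x ≡ z × M (move d x) ≡ false) ⊎ (move d x ≡ z × M x ≡ false) →
    endpoint-in-M (x , d) ≡ z × crossesM (x , d) ≡ 1
  crossing-edge x d z∈M z∈R (inj₁ (refl , Mx+d)) rewrite z∈M | z∈R | Mx+d = refl , refl
  crossing-edge x d z∈M z∈R (inj₂ (refl , Mx)) rewrite z∈M | z∈R | Mx | ∨-zeroʳ (inR x) = refl , refl

  exit : Pt → Pt × Dir
  exit z with M (right z) | M (left z) | M (up z)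
  ... | false | _     | _     = z , horizontal
  ... | true  | false | _     = left z , horizontal
  ... | true  | true  | false = z , vertical
  ... | true  | true  | true  = down z , vertical

  down-outside : ∀ {z} → InDelta M z → M (right z) ≡ true → M (left z) ≡ true → M (up z) ≡ true →
                 M (down z) ≡ false
  down-outside {z} (_ , y , adj , y∉M) r l u with Adj-cases z y adj
  ... | inj₁ refl = contradiction (trans (sym r) y∉M) λ ()
  ... | inj₂ (inj₁ refl) = contradiction (trans (sym l) (trans (cong M (left-right y)) y∉M)) λ ()
  ... | inj₂ (inj₂ (inj₁ refl)) = contradiction (trans (sym u) y∉M) λ ()
  ... | inj₂ (inj₂ (inj₂ refl)) = trans (cong M (down-up y)) y∉M

  box-neighbourhood : ∀ {z} → InRect R z → z ∈ box N × left z ∈ box N × down z ∈ box N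
  box-neighbourhood {x , y} z∈R =
    ∈-box N (∣∣≤⇒∈-range N ∣x∣≤N) (∣∣≤⇒∈-range N ∣y∣≤N) ,
    ∈-box N (∣∣≤⇒pred∈-range N {x} ∣x∣≤N) (∣∣≤⇒∈-range N ∣y∣≤N) ,
    ∈-box N (∣∣≤⇒∈-range N ∣x∣≤N) (∣∣≤⇒pred∈-range N {y} ∣y∣≤N)
    where
    ∣x∣≤N : ℤ.∣ x ∣ ℕ.≤ N
    ∣x∣≤N = proj₁ (InRect⇒∣∣≤ R z∈R)
    ∣y∣≤N : ℤ.∣ y ∣ ℕ.≤ N
    ∣y∣≤N = proj₂ (InRect⇒∣∣≤ R z∈R)

  exit-spec : ∀ z → InDelta M z → InRect R z →
              endpoint-in-M (exit z) ≡ z × exit z ∈ edges × crossesM (exit z) ≡ 1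
  exit-spec z δz@(z∈M , _) z∈R = by-cases
    where
    edge-at : ∀ x d → x ∈ box N → (x ≡ z × M (move d x) ≡ false) ⊎ (move d x ≡ z × M x ≡ false) →
              endpoint-in-M (x , d) ≡ z × (x , d) ∈ edges × crossesM (x , d) ≡ 1
    edge-at x d x∈ cross =
      let (end , one) = crossing-edge x d z∈M (InRect⇒rectᵇ R z z∈R) cross in end , ∈-edges d x∈ , one
    z∈box : z ∈ box N
    z∈box = proj₁ (box-neighbourhood z∈R)
    left∈box : left z ∈ box N
    left∈box = proj₁ (proj₂ (box-neighbourhood z∈R))
    down∈box : down z ∈ box N
    down∈box = proj₂ (proj₂ (box-neighbourhood z∈R))
    by-cases : endpoint-in-M (exit z) ≡ z × exit z ∈ edges × crossesM (exit z) ≡ 1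
    by-cases with M (right z) in e₁ | M (left z) in e₂ | M (up z) in e₃
    ... | false | _     | _     = edge-at z horizontal z∈box (inj₁ (refl , e₁))
    ... | true  | false | _     = edge-at (left z) horizontal left∈box (inj₂ (right-left z , e₂))
    ... | true  | true  | false = edge-at z vertical z∈box (inj₁ (refl , e₃))
    ... | true  | true  | true  =
      edge-at (down z) vertical down∈box (inj₂ (up-down z , down-outside δz e₁ e₂ e₃))

  Good : Pt → Set
  Good z = InDelta M z × InRect R z

  boundary-≥ : ∀ zs → Unique zs → All Good zs → length zs ℕ.≤ boundaryCount U M
  boundary-≥ zs uzs good = begin
    length zs                   ≡⟨ sym (length-map exit zs) ⟩
    length (map exit zs)        ≤⟨ length≤sum crossesM unique-exits exits⊆edges exits-cross ⟩
    sumℕ (map crossesM edges)   ≡⟨ sym boundaryCount-edges ⟩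
    boundaryCount U M           ∎
    where
    open ℕ.≤-Reasoning
    spec : ∀ {z} → z ∈ zs → endpoint-in-M (exit z) ≡ z × exit z ∈ edges × crossesM (exit z) ≡ 1
    spec z∈ = let (δz , z∈R) = All.lookup good z∈ in exit-spec _ δz z∈R
    endpoints≡ : map endpoint-in-M (map exit zs) ≡ zs
    endpoints≡ = trans (sym (map-∘ zs)) (map-id-local (All.tabulate (proj₁ ∘ spec)))
    unique-exits : Unique (map exit zs)
    unique-exits = Unique.map⁻ (subst Unique (sym endpoints≡) uzs)
    exits⊆edges : map exit zs ⊆ edges
    exits⊆edges e∈ with ∈-map⁻ exit e∈
    ... | z , z∈ , refl = proj₁ (proj₂ (spec z∈))
    exits-cross : ∀ {e} → e ∈ map exit zs → 1 ℕ.≤ crossesM e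
    exits-cross e∈ with ∈-map⁻ exit e∈
    ... | z , z∈ , refl = ℕ.≤-reflexive (sym (proj₂ (proj₂ (spec z∈))))

  length-≤-semiperimeter : Minimal M → ∀ zs → Unique zs → All Good zs →
                           length zs ℕ.≤ 2 ℕ.+ (width R ℕ.+ height R)
  length-≤-semiperimeter (_ , minimal) zs uzs good = ℕ.*-cancelˡ-≤ 2 (begin
    2 ℕ.* length zs
      ≡⟨ cong (length zs ℕ.+_) (ℕ.+-identityʳ _) ⟩
    length zs ℕ.+ length zs
      ≤⟨ ℕ.+-mono-≤ (≤-competitor filled filled-⊆ filled-τ) (≤-competitor emptied emptied-⊆ emptied-τ) ⟩
    boundaryCount U filled ℕ.+ boundaryCount U emptied
      ≤⟨ perimeter ⟩
    2 ℕ.* (2 ℕ.+ (width R ℕ.+ height R)) ∎)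
    where
    open ℕ.≤-Reasoning
    ≤-competitor : ∀ K → (∀ z → K z ≡ true → InClosure inR z) → (∀ z → InTau inR z → K z ≡ M z) →
                   length zs ℕ.≤ boundaryCount U K
    ≤-competitor K K⊆ K-τ = ℕ.≤-trans (boundary-≥ zs uzs good) (minimal U K K⊆ K-τ)

rectangle-bound : ∀ {M} → Minimal M → RectangleBound (InDelta M)
rectangle-bound {M} minimal R = IsoperimetricBound.length-≤-semiperimeter M R minimal

turn unturn : Pt → Pt
turn   (p , q) = (ℤ.- q , p)
unturn (p , q) = (q , ℤ.- p)

unturn-turn : ∀ z → unturn (turn z) ≡ z
unturn-turn (p , q) = cong (p ,_) (ℤ.neg-involutive q)

turn-unturn : ∀ z → turn (unturn z) ≡ z
turn-unturn (p , q) = cong (_, q) (ℤ.neg-involutive p)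

turn-Adj : ∀ {z w} → Adj z w → Adj (turn z) (turn w)
turn-Adj {p , q} {p′ , q′} adj =
  trans (cong (ℕ._+ ℤ.∣ p ℤ.- p′ ∣) (∣-i--j∣≡∣i-j∣ q q′)) (trans (ℕ.+-comm _ ℤ.∣ p ℤ.- p′ ∣) adj)

rotate unrotate : ℕ → Pt → Pt
rotate zero    z = z
rotate (suc k) z = turn (rotate k z)
unrotate zero    z = z
unrotate (suc k) z = unrotate k (unturn z)

unrotate-rotate : ∀ k z → unrotate k (rotate k z) ≡ z
unrotate-rotate zero    z = refl
unrotate-rotate (suc k) z = trans (cong (unrotate k) (unturn-turn (rotate k z))) (unrotate-rotate k z)

rotate-unrotate : ∀ k z → rotate k (unrotate k z) ≡ z
rotate-unrotate zero    z = refl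
rotate-unrotate (suc k) z = trans (cong turn (rotate-unrotate k (unturn z))) (turn-unturn z)

rotate-injective : ∀ k {z w} → rotate k z ≡ rotate k w → z ≡ w
rotate-injective k {z} {w} e =
  trans (sym (unrotate-rotate k z)) (trans (cong (unrotate k) e) (unrotate-rotate k w))

unrotate-injective : ∀ k {z w} → unrotate k z ≡ unrotate k w → z ≡ w
unrotate-injective k {z} {w} e =
  trans (sym (rotate-unrotate k z)) (trans (cong (rotate k) e) (rotate-unrotate k w))

rotate-Adj : ∀ k {z w} → Adj z w → Adj (rotate k z) (rotate k w)
rotate-Adj zero    adj = adj
rotate-Adj (suc k) {z} {w} adj = turn-Adj {rotate k z} {rotate k w} (rotate-Adj k adj)

rotatePath : ℕ → InfSimplePath → InfSimplePath
rotatePath k P = record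
  { vert   = rotate k ∘ vert P
  ; step   = λ n → rotate-Adj k {vert P n} {vert P (suc n)} (step P n)
  ; simple = λ m n e → simple P m n (rotate-injective k e)
  }

unturn-rect : Rect → Rect
unturn-rect (rect x₀ y₀ w h) = rect y₀ (ℤ.- (x₀ ℤ.+ + w)) h w

InRect-unturn : ∀ R {z} → InRect R z → InRect (unturn-rect R) (unturn z)
InRect-unturn (rect x₀ y₀ w h) {p , q} ((x₀≤p , p≤x₀+w) , q∈) =
  q∈ , ℤ.neg-mono-≤ p≤x₀+w , subst (ℤ.- p ℤ.≤_) (sym (-[i+j]+j≡-i x₀ (+ w))) (ℤ.neg-mono-≤ x₀≤p)
  where
  -[i+j]+j≡-i : ∀ i j → ℤ.- (i ℤ.+ j) ℤ.+ j ≡ ℤ.- i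
  -[i+j]+j≡-i = solve-∀

unrotate-rect : ℕ → Rect → Rect
unrotate-rect zero    R = R
unrotate-rect (suc k) R = unrotate-rect k (unturn-rect R)

InRect-unrotate : ∀ k R {z} → InRect R z → InRect (unrotate-rect k R) (unrotate k z)
InRect-unrotate zero    R z∈R = z∈R
InRect-unrotate (suc k) R z∈R = InRect-unrotate k (unturn-rect R) (InRect-unturn R z∈R)

unrotate-rect-semiperimeter : ∀ k R →
  width (unrotate-rect k R) ℕ.+ height (unrotate-rect k R) ≡ width R ℕ.+ height R
unrotate-rect-semiperimeter zero    R = refl
unrotate-rect-semiperimeter (suc k) R =
  trans (unrotate-rect-semiperimeter k (unturn-rect R)) (ℕ.+-comm (height R) (width R))

RectangleBound-unrotate : ∀ {Good} k → RectangleBound Good → RectangleBound (Good ∘ unrotate k)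
RectangleBound-unrotate {Good} k bound R zs uzs good = begin
  length zs                        ≡⟨ sym (length-map (unrotate k) zs) ⟩
  length (map (unrotate k) zs)     ≤⟨ bound R′ (map (unrotate k) zs) (Unique.map⁺ (unrotate-injective k) uzs) good′ ⟩
  2 ℕ.+ (width R′ ℕ.+ height R′)   ≡⟨ cong (2 ℕ.+_) (unrotate-rect-semiperimeter k R) ⟩
  2 ℕ.+ (width R ℕ.+ height R)     ∎
  where
  open ℕ.≤-Reasoning
  R′ : Rect
  R′ = unrotate-rect k R
  good′ : All (λ w → Good w × InRect R′ w) (map (unrotate k) zs)
  good′ = All.map⁺ (All.map (λ (gz , z∈R) → gz , InRect-unrotate k R z∈R) good)

ℚ-ring : AlmostCommutativeRing 0ℓ 0ℓ
ℚ-ring = fromCommutativeRing ℚ.+-*-commutativeRing (λ x → dec⇒maybe (0ℚ ℚ.≟ x))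

neg-involutive : ∀ p → - - p ≡ p
neg-involutive = ring-solve-∀ ℚ-ring

-p*-q≡p*q : ∀ p q → - p * - q ≡ p * q
-p*-q≡p*q = ring-solve-∀ ℚ-ring

p*[q*r]≡q*[p*r] : ∀ p q r → p * (q * r) ≡ q * (p * r)
p*[q*r]≡q*[p*r] = ring-solve-∀ ℚ-ring

mkℚ/1 : ℤ → ℚ
mkℚ/1 x = mkℚ x 0 (Coprime.sym (Coprime.1-coprimeTo ℤ.∣ x ∣))

ℤtoℚ≡mkℚ/1 : ∀ x → ℤtoℚ x ≡ mkℚ/1 x
ℤtoℚ≡mkℚ/1 x = ℚ.↥p/↧p≡p (mkℚ/1 x)

ℤtoℚ-+ : ∀ x y → ℤtoℚ (x ℤ.+ y) ≡ ℤtoℚ x + ℤtoℚ y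
ℤtoℚ-+ x y rewrite ℤtoℚ≡mkℚ/1 x | ℤtoℚ≡mkℚ/1 y =
  ℚ./-cong (cong₂ ℤ._+_ (sym (ℤ.*-identityʳ x)) (sym (ℤ.*-identityʳ y))) refl

ℤtoℚ-* : ∀ x y → ℤtoℚ (x ℤ.* y) ≡ ℤtoℚ x * ℤtoℚ y
ℤtoℚ-* x y rewrite ℤtoℚ≡mkℚ/1 x | ℤtoℚ≡mkℚ/1 y = refl

ℤtoℚ-neg : ∀ x → ℤtoℚ (ℤ.- x) ≡ - ℤtoℚ x
ℤtoℚ-neg x rewrite ℤtoℚ≡mkℚ/1 x | ℤtoℚ≡mkℚ/1 (ℤ.- x) = mkℚ-neg x
  where
  mkℚ-neg : ∀ x → mkℚ/1 (ℤ.- x) ≡ - mkℚ/1 x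
  mkℚ-neg (+ zero)  = refl
  mkℚ-neg (+ suc n) = refl
  mkℚ-neg -[1+ n ]  = refl

ℤtoℚ-- : ∀ x y → ℤtoℚ (x ℤ.- y) ≡ ℤtoℚ x - ℤtoℚ y
ℤtoℚ-- x y = trans (ℤtoℚ-+ x (ℤ.- y)) (cong (_+_ (ℤtoℚ x)) (ℤtoℚ-neg y))

ℤtoℚ-pos-+ : ∀ m n → ℤtoℚ (+ (m ℕ.+ n)) ≡ ℤtoℚ (+ m) + ℤtoℚ (+ n)
ℤtoℚ-pos-+ m n = trans (cong ℤtoℚ (ℤ.pos-+ m n)) (ℤtoℚ-+ (+ m) (+ n))

ℤtoℚ-pos-* : ∀ m n → ℤtoℚ (+ (m ℕ.* n)) ≡ ℤtoℚ (+ m) * ℤtoℚ (+ n)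
ℤtoℚ-pos-* m n = trans (cong ℤtoℚ (ℤ.pos-* m n)) (ℤtoℚ-* (+ m) (+ n))

ℤtoℚ-mono-≤ : ∀ {x y} → x ℤ.≤ y → ℤtoℚ x ≤ ℤtoℚ y
ℤtoℚ-mono-≤ {x} {y} x≤y rewrite ℤtoℚ≡mkℚ/1 x | ℤtoℚ≡mkℚ/1 y =
  *≤* (subst₂ ℤ._≤_ (sym (ℤ.*-identityʳ x)) (sym (ℤ.*-identityʳ y)) x≤y)

0≤ℤtoℚ+ : ∀ n → 0ℚ ≤ ℤtoℚ (+ n)
0≤ℤtoℚ+ n = ℤtoℚ-mono-≤ {+ 0} {+ n} (+≤+ z≤n)

0≤ℤtoℚ-diff : ∀ {x y} → x ℤ.≤ y → 0ℚ ≤ ℤtoℚ (y ℤ.- x)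
0≤ℤtoℚ-diff {x} {y} x≤y = ℤtoℚ-mono-≤ {+ 0} {y ℤ.- x} (ℤ.i≤j⇒0≤j-i x≤y)

ℤtoℚ-cancel-≤ : ∀ {x y} → ℤtoℚ x ≤ ℤtoℚ y → x ℤ.≤ y
ℤtoℚ-cancel-≤ {x} {y} h rewrite ℤtoℚ≡mkℚ/1 x | ℤtoℚ≡mkℚ/1 y =
  subst₂ ℤ._≤_ (ℤ.*-identityʳ x) (ℤ.*-identityʳ y) (ℚ.drop-*≤* h)

1/[1+_] : ℕ → ℚ
1/[1+ n ] = + 1 / suc n

1/[1+n]≡mkℚ : ∀ n → 1/[1+ n ] ≡ mkℚ (+ 1) n (Coprime.1-coprimeTo (suc n))
1/[1+n]≡mkℚ n = ℚ.↥p/↧p≡p (mkℚ (+ 1) n (Coprime.1-coprimeTo (suc n)))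

0≤1/[1+n] : ∀ n → 0ℚ ≤ 1/[1+ n ]
0≤1/[1+n] n rewrite 1/[1+n]≡mkℚ n = *≤* (+≤+ z≤n)

k/[1+n]≡k*1/[1+n] : ∀ k n → + k / suc n ≡ ℤtoℚ (+ k) * 1/[1+ n ]
k/[1+n]≡k*1/[1+n] k n rewrite 1/[1+n]≡mkℚ n | ℤtoℚ≡mkℚ/1 (+ k) =
  ℚ./-cong (sym (ℤ.*-identityʳ (+ k))) (sym (ℕ.*-identityˡ (suc n)))

[1+n]*1/[1+n]≡1 : ∀ n → ℤtoℚ (+ suc n) * 1/[1+ n ] ≡ 1ℚ
[1+n]*1/[1+n]≡1 n rewrite 1/[1+n]≡mkℚ n | ℤtoℚ≡mkℚ/1 (+ suc n) = ℚ.*-inverseʳ (mkℚ/1 (+ suc n))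

k*1/[1+n]≤1 : ∀ {k n} → k ℕ.≤ suc n → ℤtoℚ (+ k) * 1/[1+ n ] ≤ 1ℚ
k*1/[1+n]≤1 {k} {n} k≤1+n = subst (ℤtoℚ (+ k) * 1/[1+ n ] ≤_) ([1+n]*1/[1+n]≡1 n)
  (ℚ.*-monoʳ-≤-nonNeg 1/[1+ n ] {{ℚ.nonNegative (0≤1/[1+n] n)}} (ℤtoℚ-mono-≤ {+ k} {+ suc n} (+≤+ k≤1+n)))

1/[1+n]≤1 : ∀ n → 1/[1+ n ] ≤ 1ℚ
1/[1+n]≤1 n = subst (_≤ 1ℚ) (ℚ.*-identityˡ 1/[1+ n ]) (k*1/[1+n]≤1 {1} {n} (s≤s z≤n))

archimedean : ∀ γ → 0ℚ < γ → ∃ λ k → 1ℚ ≤ ℤtoℚ (+ k) * γ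
archimedean γ@(mkℚ (+ suc n) d _) _ = suc d , (begin
  1ℚ
    ≤⟨ ℤtoℚ-mono-≤ {+ 1} {+ suc n} (+≤+ (s≤s z≤n)) ⟩
  ℤtoℚ (+ suc n)
    ≡⟨ sym (ℚ.*-identityʳ _) ⟩
  ℤtoℚ (+ suc n) * 1ℚ
    ≡⟨ cong (ℤtoℚ (+ suc n) *_) (sym ([1+n]*1/[1+n]≡1 d)) ⟩
  ℤtoℚ (+ suc n) * (ℤtoℚ (+ suc d) * 1/[1+ d ])
    ≡⟨ p*[q*r]≡q*[p*r] (ℤtoℚ (+ suc n)) (ℤtoℚ (+ suc d)) 1/[1+ d ] ⟩
  ℤtoℚ (+ suc d) * (ℤtoℚ (+ suc n) * 1/[1+ d ])
    ≡⟨ cong (ℤtoℚ (+ suc d) *_) (sym (k/[1+n]≡k*1/[1+n] (suc n) d)) ⟩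
  ℤtoℚ (+ suc d) * (+ suc n / suc d)
    ≡⟨ cong (ℤtoℚ (+ suc d) *_) (ℚ.↥p/↧p≡p γ) ⟩
  ℤtoℚ (+ suc d) * γ ∎)
  where open ℚ.≤-Reasoning
archimedean (mkℚ (+ zero) _ _) (*<* (ℤ.+<+ ()))
archimedean (mkℚ -[1+ _ ] _ _) (*<* ())

∣p∣*∣p∣≡p*p : ∀ p → ∣ p ∣ * ∣ p ∣ ≡ p * p
∣p∣*∣p∣≡p*p p with ℚ.∣p∣≡p∨∣p∣≡-p p
... | inj₁ ∣p∣≡p  = cong (λ x → x * x) ∣p∣≡p
... | inj₂ ∣p∣≡-p = trans (cong (λ x → x * x) ∣p∣≡-p) (-p*-q≡p*q p p)

p≤∣p∣ : ∀ p → p ≤ ∣ p ∣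
p≤∣p∣ p with ℚ.∣p∣≡p∨∣p∣≡-p p
... | inj₁ ∣p∣≡p  = ℚ.≤-reflexive (sym ∣p∣≡p)
... | inj₂ ∣p∣≡-p = ℚ.≤-trans p≤0 (ℚ.0≤∣p∣ p)
  where
  p≤0 : p ≤ 0ℚ
  p≤0 = subst₂ _≤_ (trans (cong -_ ∣p∣≡-p) (neg-involutive p)) refl (ℚ.neg-antimono-≤ (ℚ.0≤∣p∣ p))

-p≤∣p∣ : ∀ p → - p ≤ ∣ p ∣
-p≤∣p∣ p = subst (- p ≤_) (ℚ.∣-p∣≡∣p∣ p) (p≤∣p∣ (- p))

∣p∣≤∣↥p∣ : ∀ p → ∣ p ∣ ≤ ℤtoℚ (+ ℤ.∣ ↥ p ∣)
∣p∣≤∣↥p∣ (mkℚ n d _) rewrite ℤtoℚ≡mkℚ/1 (+ ℤ.∣ n ∣) =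
  *≤* (subst₂ ℤ._≤_ (ℤ.pos-* ℤ.∣ n ∣ 1) (ℤ.pos-* ℤ.∣ n ∣ (suc d)) (+≤+ (ℕ.*-monoʳ-≤ ℤ.∣ n ∣ (s≤s z≤n))))

∣p∣≤q : ∀ {p q} → - q ≤ p → p ≤ q → ∣ p ∣ ≤ q
∣p∣≤q {p} {q} -q≤p p≤q with ℚ.∣p∣≡p∨∣p∣≡-p p
... | inj₁ ∣p∣≡p  = subst (_≤ q) (sym ∣p∣≡p) p≤q
... | inj₂ ∣p∣≡-p = subst₂ _≤_ (sym ∣p∣≡-p) (neg-involutive q) (ℚ.neg-antimono-≤ -q≤p)

0≤p*q : ∀ {p q} → 0ℚ ≤ p → 0ℚ ≤ q → 0ℚ ≤ p * q
0≤p*q {p} {q} 0≤p 0≤q = subst (_≤ p * q) (ℚ.*-zeroʳ p) (ℚ.*-monoˡ-≤-nonNeg p {{ℚ.nonNegative 0≤p}} 0≤q)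

0≤p*p : ∀ p → 0ℚ ≤ p * p
0≤p*p p with ℚ.≤-total 0ℚ p
... | inj₁ 0≤p = 0≤p*q 0≤p 0≤p
... | inj₂ p≤0 = subst (0ℚ ≤_) (-p*-q≡p*q p p) (0≤p*q 0≤-p 0≤-p)
  where
  0≤-p : 0ℚ ≤ - p
  0≤-p = ℚ.neg-antimono-≤ p≤0

p≤p+q : ∀ p {q} → 0ℚ ≤ q → p ≤ p + q
p≤p+q p {q} 0≤q = subst (_≤ p + q) (ℚ.+-identityʳ p) (ℚ.+-monoʳ-≤ p 0≤q)

weighted-sum≤ : ∀ {u v x y B} → 0ℚ ≤ u → 0ℚ ≤ v → x ≤ B → y ≤ B → u * x + v * y ≤ (u + v) * B
weighted-sum≤ {u} {v} {x} {y} {B} 0≤u 0≤v x≤B y≤B = begin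
  u * x + v * y   ≤⟨ ℚ.+-mono-≤ (ℚ.*-monoˡ-≤-nonNeg u {{ℚ.nonNegative 0≤u}} x≤B)
                                (ℚ.*-monoˡ-≤-nonNeg v {{ℚ.nonNegative 0≤v}} y≤B) ⟩
  u * B + v * B   ≡⟨ sym (ℚ.*-distribʳ-+ B u v) ⟩
  (u + v) * B     ∎
  where open ℚ.≤-Reasoning

c*u≤2κ : ∀ {c t u κ} → 0ℚ < c → 0ℚ ≤ t → 0ℚ ≤ κ →
         u * (c * c + t * t) ≤ (c + t) * κ → c * u ≤ κ + κ
c*u≤2κ {c} {t} {u} {κ} 0<c 0≤t 0≤κ hyp with ℚ.≤-total u 0ℚ
... | inj₁ u≤0 = ℚ.≤-trans (subst (c * u ≤_) (ℚ.*-zeroʳ c) (ℚ.*-monoˡ-≤-nonNeg c {{ℚ.nonNegative 0≤c}} u≤0))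
                           (ℚ.+-mono-≤ 0≤κ 0≤κ)
  where
  0≤c : 0ℚ ≤ c
  0≤c = ℚ.<⇒≤ 0<c
... | inj₂ 0≤u = ℚ.*-cancelˡ-≤-pos (c + t) {{ℚ.positive 0<c+t}} (begin
  (c + t) * (c * u)                                             ≤⟨ p≤p+q _ (0≤p*q 0≤u 0≤rest) ⟩
  (c + t) * (c * u) + u * ((c - t) * (c - t) + c * t + t * t)   ≡⟨ expand c t u ⟩
  u * (c * c + t * t) + u * (c * c + t * t)                     ≤⟨ ℚ.+-mono-≤ hyp hyp ⟩
  (c + t) * κ + (c + t) * κ                                     ≡⟨ sym (ℚ.*-distribˡ-+ (c + t) κ κ) ⟩
  (c + t) * (κ + κ)                                             ∎)
  where
  open ℚ.≤-Reasoning
  0≤c : 0ℚ ≤ c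
  0≤c = ℚ.<⇒≤ 0<c
  0<c+t : 0ℚ < c + t
  0<c+t = ℚ.<-≤-trans 0<c (p≤p+q c 0≤t)
  0≤rest : 0ℚ ≤ (c - t) * (c - t) + c * t + t * t
  0≤rest = ℚ.+-mono-≤ (ℚ.+-mono-≤ (0≤p*p (c - t)) (0≤p*q 0≤c 0≤t)) (0≤p*p t)
  expand : ∀ c t u → (c + t) * (c * u) + u * ((c - t) * (c - t) + c * t + t * t) ≡
                     u * (c * c + t * t) + u * (c * c + t * t)
  expand = ring-solve-∀ ℚ-ring

negℝ : ℝ → ℝ
negℝ x = record
  { seq     = λ n → - seq x n
  ; regular = λ m n → subst (_≤ 1/[1+ m ] + 1/[1+ n ]) (sym (∣-p--q∣≡∣p-q∣ (seq x m) (seq x n))) (regular x m n)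
  }
  where
  ∣-p--q∣≡∣p-q∣ : ∀ p q → ∣ - p - - q ∣ ≡ ∣ p - q ∣
  ∣-p--q∣≡∣p-q∣ p q = trans (cong ∣_∣ (-p--q≡-[p-q] p q)) (ℚ.∣-p∣≡∣p∣ (p - q))
    where
    -p--q≡-[p-q] : ∀ p q → - p - - q ≡ - (p - q)
    -p--q≡-[p-q] = ring-solve-∀ ℚ-ring

NonZeroℝ-neg : ∀ {x} → NonZeroℝ x → NonZeroℝ (negℝ x)
NonZeroℝ-neg {x} (m , h) = m , subst (1/[1+ m ] <_) (sym (ℚ.∣-p∣≡∣p∣ (seq x m))) h

seq-lower : ∀ x m n → seq x m - (1/[1+ m ] + 1/[1+ n ]) ≤ seq x n
seq-lower x m n = begin
  seq x m - (1/[1+ m ] + 1/[1+ n ])   ≤⟨ ℚ.+-monoʳ-≤ (seq x m) (ℚ.neg-antimono-≤ xm-xn≤) ⟩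
  seq x m - (seq x m - seq x n)       ≡⟨ p-[p-q]≡q (seq x m) (seq x n) ⟩
  seq x n                             ∎
  where
  open ℚ.≤-Reasoning
  xm-xn≤ : seq x m - seq x n ≤ 1/[1+ m ] + 1/[1+ n ]
  xm-xn≤ = ℚ.≤-trans (p≤∣p∣ (seq x m - seq x n)) (regular x m n)
  p-[p-q]≡q : ∀ p q → p - (p - q) ≡ q
  p-[p-q]≡q = ring-solve-∀ ℚ-ring

-- By regularity x n ≥ x m - 1/(m+1) - 1/(n+1); once k (x m - 1/(m+1)) ≥ 1, g = 2k works for
-- every n with g ≤ n + 1.
eventually-bounded-below : ∀ x m → 1/[1+ m ] < seq x m →
                           ∃ λ g → ∀ n → g ℕ.≤ suc n → 1ℚ ≤ ℤtoℚ (+ g) * seq x n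
eventually-bounded-below x m apart = k ℕ.+ k , λ n g≤1+n → begin
  1ℚ                                                   ≡⟨ refl ⟩
  1ℚ + 1ℚ - 1ℚ                                         ≤⟨ ℚ.+-mono-≤ (ℚ.+-mono-≤ 1≤kγ 1≤kγ)
                                                                      (ℚ.neg-antimono-≤ (k*1/[1+n]≤1 g≤1+n)) ⟩
  ℤtoℚ (+ k) * γ + ℤtoℚ (+ k) * γ - ℤtoℚ (+ (k ℕ.+ k)) * 1/[1+ n ]
    ≡⟨ cong (λ g → ℤtoℚ (+ k) * γ + ℤtoℚ (+ k) * γ - g * 1/[1+ n ]) (ℤtoℚ-+ (+ k) (+ k)) ⟩
  ℤtoℚ (+ k) * γ + ℤtoℚ (+ k) * γ - (ℤtoℚ (+ k) + ℤtoℚ (+ k)) * 1/[1+ n ]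
    ≡⟨ regroup (ℤtoℚ (+ k)) (seq x m) 1/[1+ m ] 1/[1+ n ] ⟩
  (ℤtoℚ (+ k) + ℤtoℚ (+ k)) * (seq x m - (1/[1+ m ] + 1/[1+ n ]))
    ≡⟨ cong (_* (seq x m - (1/[1+ m ] + 1/[1+ n ]))) (sym (ℤtoℚ-+ (+ k) (+ k))) ⟩
  ℤtoℚ (+ (k ℕ.+ k)) * (seq x m - (1/[1+ m ] + 1/[1+ n ]))
    ≤⟨ ℚ.*-monoˡ-≤-nonNeg (ℤtoℚ (+ (k ℕ.+ k))) {{ℚ.nonNegative (0≤ℤtoℚ+ (k ℕ.+ k))}} (seq-lower x m n) ⟩
  ℤtoℚ (+ (k ℕ.+ k)) * seq x n ∎
  where
  open ℚ.≤-Reasoning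
  γ : ℚ
  γ = seq x m - 1/[1+ m ]
  γ>0 : 0ℚ < γ
  γ>0 = subst (_< γ) (ℚ.+-inverseʳ 1/[1+ m ]) (ℚ.+-monoˡ-< (- 1/[1+ m ]) apart)
  k : ℕ
  k = proj₁ (archimedean γ γ>0)
  1≤kγ : 1ℚ ≤ ℤtoℚ (+ k) * γ
  1≤kγ = proj₂ (archimedean γ γ>0)
  regroup : ∀ k c r s → k * (c - r) + k * (c - r) - (k + k) * s ≡ (k + k) * (c - (r + s))
  regroup = ring-solve-∀ ℚ-ring

seq-bounded : ∀ x → ∃ λ σ → ∀ n → ∣ seq x n ∣ ≤ ℤtoℚ (+ σ)
seq-bounded x = ℤ.∣ ↥ seq x 0 ∣ ℕ.+ 2 , λ n → begin
  ∣ seq x n ∣                               ≡⟨ cong ∣_∣ (sym (p+[q-p]≡q (seq x 0) (seq x n))) ⟩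
  ∣ seq x 0 + (seq x n - seq x 0) ∣         ≤⟨ ℚ.∣p+q∣≤∣p∣+∣q∣ (seq x 0) _ ⟩
  ∣ seq x 0 ∣ + ∣ seq x n - seq x 0 ∣       ≤⟨ ℚ.+-mono-≤ (∣p∣≤∣↥p∣ (seq x 0)) ∣xn-x0∣≤2 ⟩
  ℤtoℚ (+ ℤ.∣ ↥ seq x 0 ∣) + ℤtoℚ (+ 2)     ≡⟨ sym (ℤtoℚ-+ (+ ℤ.∣ ↥ seq x 0 ∣) (+ 2)) ⟩
  ℤtoℚ (+ (ℤ.∣ ↥ seq x 0 ∣ ℕ.+ 2))          ∎
  where
  open ℚ.≤-Reasoning
  p+[q-p]≡q : ∀ p q → p + (q - p) ≡ q
  p+[q-p]≡q = ring-solve-∀ ℚ-ring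
  ∣xn-x0∣≤2 : ∀ {n} → ∣ seq x n - seq x 0 ∣ ≤ ℤtoℚ (+ 2)
  ∣xn-x0∣≤2 {n} = ℚ.≤-trans (regular x n 0) (ℚ.+-mono-≤ (1/[1+n]≤1 n) (1/[1+n]≤1 0))

-- The coordinates of (p , q) along the direction (c , s) and along (- s , c); at precision n they
-- are the terms approx p q c s n and approx q (- p) c s n of Defs.
along across : ℚ → ℚ → Pt → ℚ
along  c s (p , q) = ℤtoℚ p * c + ℤtoℚ q * s
across c s (p , q) = ℤtoℚ q * c + ℤtoℚ (ℤ.- p) * s

InRatStrip : ℚ → ℚ → ℤ → ℤ → ℤ → Pt → Set
InRatStrip c s a b e z = ℤtoℚ a ≤ along c s z × along c s z ≤ ℤtoℚ b × ℤtoℚ e ≤ across c s z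

ℤtoℚ-+1 : ∀ x → ℤtoℚ (x ℤ.+ + 1) ≡ ℤtoℚ x + 1ℚ
ℤtoℚ-+1 x = ℤtoℚ-+ x (+ 1)

ℤtoℚ--1 : ∀ x → ℤtoℚ (x ℤ.- + 1) ≡ ℤtoℚ x - 1ℚ
ℤtoℚ--1 x = ℤtoℚ-- x (+ 1)

err≤1 : ∀ {p q n} → ℤ.∣ p ∣ ℕ.+ ℤ.∣ q ∣ ℕ.≤ suc n → err p q n ≤ 1ℚ
err≤1 {p} {q} {n} size≤ =
  subst (_≤ 1ℚ) (sym (k/[1+n]≡k*1/[1+n] (ℤ.∣ p ∣ ℕ.+ ℤ.∣ q ∣) n)) (k*1/[1+n]≤1 size≤)

LinGE⇒≤ : ∀ {a p q c s n} → LinGE a p q c s → ℤ.∣ p ∣ ℕ.+ ℤ.∣ q ∣ ℕ.≤ suc n →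
          ℤtoℚ (a ℤ.- + 1) ≤ approx p q c s n
LinGE⇒≤ {a} {p} {q} {c} {s} {n} a≤ size≤ = begin
  ℤtoℚ (a ℤ.- + 1)                    ≡⟨ ℤtoℚ--1 a ⟩
  ℤtoℚ a - 1ℚ                         ≤⟨ ℚ.+-monoˡ-≤ (- 1ℚ) (a≤ n) ⟩
  approx p q c s n + err p q n - 1ℚ
    ≤⟨ ℚ.+-monoˡ-≤ (- 1ℚ) (ℚ.+-monoʳ-≤ (approx p q c s n) (err≤1 {p} {q} size≤)) ⟩
  approx p q c s n + 1ℚ - 1ℚ          ≡⟨ p+1-1≡p (approx p q c s n) ⟩
  approx p q c s n                    ∎
  where
  open ℚ.≤-Reasoning
  p+1-1≡p : ∀ p → p + 1ℚ - 1ℚ ≡ p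
  p+1-1≡p = ring-solve-∀ ℚ-ring

LinLE⇒≤ : ∀ {b p q c s n} → LinLE b p q c s → ℤ.∣ p ∣ ℕ.+ ℤ.∣ q ∣ ℕ.≤ suc n →
          approx p q c s n ≤ ℤtoℚ (b ℤ.+ + 1)
LinLE⇒≤ {b} {p} {q} {c} {s} {n} ≤b size≤ = begin
  approx p q c s n     ≤⟨ ≤b n ⟩
  ℤtoℚ b + err p q n   ≤⟨ ℚ.+-monoʳ-≤ (ℤtoℚ b) (err≤1 {p} {q} size≤) ⟩
  ℤtoℚ b + 1ℚ          ≡⟨ sym (ℤtoℚ-+1 b) ⟩
  ℤtoℚ (b ℤ.+ + 1)     ∎
  where open ℚ.≤-Reasoning

-- Once ∣ p ∣ + ∣ q ∣ ≤ n + 1 the error terms err of Defs are at most 1, so at precision n the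
-- half-strip lies in a rational strip widened by 1.
InHalfStrip⇒InRatStrip : ∀ H {p q n} → InHalfStrip H (p , q) → ℤ.∣ p ∣ ℕ.+ ℤ.∣ q ∣ ℕ.≤ suc n →
  let open HalfStrip H in
  InRatStrip (seq c n) (seq s n) (a ℤ.- + 1) (b ℤ.+ + 1) (e ℤ.- + 1) (p , q)
InHalfStrip⇒InRatStrip H {p} {q} {n} (a≤ , ≤b , e≤) size≤ =
  LinGE⇒≤ {a} {p} {q} {c} {s} a≤ size≤ ,
  LinLE⇒≤ {b} {p} {q} {c} {s} ≤b size≤ ,
  LinGE⇒≤ {e} {q} {ℤ.- p} {c} {s} e≤ size′≤
  where
  open HalfStrip H
  size′≤ : ℤ.∣ q ∣ ℕ.+ ℤ.∣ ℤ.- p ∣ ℕ.≤ suc n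
  size′≤ = subst (ℕ._≤ suc n) (trans (ℕ.+-comm ℤ.∣ p ∣ ℤ.∣ q ∣) (cong (ℤ.∣ q ∣ ℕ.+_) (sym (ℤ.∣-i∣≡∣i∣ p))))
                 size≤

-- (qⱼ - qᵢ) times the horizontal offset of (p , q) from the chord through (pᵢ , qᵢ) and (pⱼ , qⱼ).
chord-excess : Pt → Pt → Pt → ℤ
chord-excess (pᵢ , qᵢ) (p , q) (pⱼ , qⱼ) = (qⱼ ℤ.- qᵢ) ℤ.* p ℤ.- (qⱼ ℤ.- q) ℤ.* pᵢ ℤ.- (q ℤ.- qᵢ) ℤ.* pⱼ

ℤtoℚ-chord-excess : ∀ pᵢ qᵢ p q pⱼ qⱼ → ℤtoℚ (chord-excess (pᵢ , qᵢ) (p , q) (pⱼ , qⱼ)) ≡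
  (ℤtoℚ qⱼ - ℤtoℚ qᵢ) * ℤtoℚ p - (ℤtoℚ qⱼ - ℤtoℚ q) * ℤtoℚ pᵢ - (ℤtoℚ q - ℤtoℚ qᵢ) * ℤtoℚ pⱼ
ℤtoℚ-chord-excess pᵢ qᵢ p q pⱼ qⱼ
  rewrite ℤtoℚ-- ((qⱼ ℤ.- qᵢ) ℤ.* p ℤ.- (qⱼ ℤ.- q) ℤ.* pᵢ) ((q ℤ.- qᵢ) ℤ.* pⱼ)
        | ℤtoℚ-- ((qⱼ ℤ.- qᵢ) ℤ.* p) ((qⱼ ℤ.- q) ℤ.* pᵢ)
        | ℤtoℚ-* (qⱼ ℤ.- qᵢ) p | ℤtoℚ-* (qⱼ ℤ.- q) pᵢ | ℤtoℚ-* (q ℤ.- qᵢ) pⱼ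
        | ℤtoℚ-- qⱼ qᵢ | ℤtoℚ-- qⱼ q | ℤtoℚ-- q qᵢ = refl

module RatStripGeometry (c s : ℚ) (a b e : ℤ) (g : ℕ) (1≤gc : 1ℚ ≤ ℤtoℚ (+ g) * c) where

  InStrip : Pt → Set
  InStrip = InRatStrip c s a b e

  ≤-scale : ∀ {X K} → 0ℚ ≤ K → c * X ≤ K → X ≤ ℤtoℚ (+ g) * K
  ≤-scale {X} {K} 0≤K cX≤K with ℚ.≤-total X 0ℚ
  ... | inj₁ X≤0 = ℚ.≤-trans X≤0 (0≤p*q (0≤ℤtoℚ+ g) 0≤K)
  ... | inj₂ 0≤X = begin
    X                      ≡⟨ sym (ℚ.*-identityˡ X) ⟩
    1ℚ * X                 ≤⟨ ℚ.*-monoʳ-≤-nonNeg X {{ℚ.nonNegative 0≤X}} 1≤gc ⟩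
    ℤtoℚ (+ g) * c * X     ≡⟨ ℚ.*-assoc (ℤtoℚ (+ g)) c X ⟩
    ℤtoℚ (+ g) * (c * X)   ≤⟨ ℚ.*-monoˡ-≤-nonNeg (ℤtoℚ (+ g)) {{ℚ.nonNegative (0≤ℤtoℚ+ g)}} cX≤K ⟩
    ℤtoℚ (+ g) * K         ∎
    where open ℚ.≤-Reasoning

  thickness : ℚ
  thickness = ℤtoℚ (+ ℤ.∣ b ℤ.- a ∣)

  slack : ℕ
  slack = g ℕ.* ℤ.∣ b ℤ.- a ∣

  along-diff≤ : ∀ z w → InStrip z → InStrip w → along c s z - along c s w ≤ thickness
  along-diff≤ z w (_ , z≤b , _) (a≤w , _ , _) = begin
    along c s z - along c s w   ≤⟨ ℚ.+-mono-≤ z≤b (ℚ.neg-antimono-≤ a≤w) ⟩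
    ℤtoℚ b - ℤtoℚ a             ≡⟨ sym (ℤtoℚ-- b a) ⟩
    ℤtoℚ (b ℤ.- a)              ≤⟨ ℤtoℚ-mono-≤ {b ℤ.- a} {+ ℤ.∣ b ℤ.- a ∣} (i≤+∣i∣ (b ℤ.- a)) ⟩
    thickness                   ∎
    where open ℚ.≤-Reasoning

  scaled-chord : ∀ {Y qᵢ q qⱼ x y} → qᵢ ℤ.≤ q → q ℤ.≤ qⱼ →
    c * Y ≡ ℤtoℚ (qⱼ ℤ.- q) * x + ℤtoℚ (q ℤ.- qᵢ) * y → x ≤ thickness → y ≤ thickness →
    Y ≤ ℤtoℚ ((qⱼ ℤ.- qᵢ) ℤ.* + slack)
  scaled-chord {Y} {qᵢ} {q} {qⱼ} {x} {y} qᵢ≤q q≤qⱼ cY≡ x≤ y≤ = begin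
    Y
      ≤⟨ ≤-scale (0≤p*q (0≤ℤtoℚ-diff qᵢ≤qⱼ) (0≤ℤtoℚ+ ℤ.∣ b ℤ.- a ∣)) cY≤ ⟩
    ℤtoℚ (+ g) * (ℤtoℚ (qⱼ ℤ.- qᵢ) * thickness)
      ≡⟨ p*[q*r]≡q*[p*r] (ℤtoℚ (+ g)) (ℤtoℚ (qⱼ ℤ.- qᵢ)) thickness ⟩
    ℤtoℚ (qⱼ ℤ.- qᵢ) * (ℤtoℚ (+ g) * thickness)
      ≡⟨ cong (ℤtoℚ (qⱼ ℤ.- qᵢ) *_) (sym (ℤtoℚ-pos-* g _)) ⟩
    ℤtoℚ (qⱼ ℤ.- qᵢ) * ℤtoℚ (+ slack)
      ≡⟨ sym (ℤtoℚ-* (qⱼ ℤ.- qᵢ) (+ slack)) ⟩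
    ℤtoℚ ((qⱼ ℤ.- qᵢ) ℤ.* + slack) ∎
    where
    open ℚ.≤-Reasoning
    qᵢ≤qⱼ : qᵢ ℤ.≤ qⱼ
    qᵢ≤qⱼ = ℤ.≤-trans qᵢ≤q q≤qⱼ
    weights : ℤtoℚ (qⱼ ℤ.- q) + ℤtoℚ (q ℤ.- qᵢ) ≡ ℤtoℚ (qⱼ ℤ.- qᵢ)
    weights = trans (sym (ℤtoℚ-+ (qⱼ ℤ.- q) (q ℤ.- qᵢ))) (cong ℤtoℚ (i-j+[j-k]≡i-k qⱼ q qᵢ))
    cY≤ : c * Y ≤ ℤtoℚ (qⱼ ℤ.- qᵢ) * thickness
    cY≤ = begin
      c * Y
        ≡⟨ cY≡ ⟩
      ℤtoℚ (qⱼ ℤ.- q) * x + ℤtoℚ (q ℤ.- qᵢ) * y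
        ≤⟨ weighted-sum≤ (0≤ℤtoℚ-diff q≤qⱼ) (0≤ℤtoℚ-diff qᵢ≤q) x≤ y≤ ⟩
      (ℤtoℚ (qⱼ ℤ.- q) + ℤtoℚ (q ℤ.- qᵢ)) * thickness
        ≡⟨ cong (_* thickness) weights ⟩
      ℤtoℚ (qⱼ ℤ.- qᵢ) * thickness ∎

  chord-excess≤ : ∀ {pᵢ qᵢ p q pⱼ qⱼ} → InStrip (pᵢ , qᵢ) → InStrip (p , q) → InStrip (pⱼ , qⱼ) →
    qᵢ ℤ.≤ q → q ℤ.≤ qⱼ → chord-excess (pᵢ , qᵢ) (p , q) (pⱼ , qⱼ) ℤ.≤ (qⱼ ℤ.- qᵢ) ℤ.* + slack
  chord-excess≤ {pᵢ} {qᵢ} {p} {q} {pⱼ} {qⱼ} zᵢ∈ z∈ zⱼ∈ qᵢ≤q q≤qⱼ = ℤtoℚ-cancel-≤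
    (scaled-chord qᵢ≤q q≤qⱼ c*excess
      (along-diff≤ (p , q) (pᵢ , qᵢ) z∈ zᵢ∈) (along-diff≤ (p , q) (pⱼ , qⱼ) z∈ zⱼ∈))
    where
    c*excess : c * ℤtoℚ (chord-excess (pᵢ , qᵢ) (p , q) (pⱼ , qⱼ)) ≡
               ℤtoℚ (qⱼ ℤ.- q) * (along c s (p , q) - along c s (pᵢ , qᵢ)) +
               ℤtoℚ (q ℤ.- qᵢ) * (along c s (p , q) - along c s (pⱼ , qⱼ))
    c*excess rewrite ℤtoℚ-chord-excess pᵢ qᵢ p q pⱼ qⱼ | ℤtoℚ-- qⱼ q | ℤtoℚ-- q qᵢ =
      identity c s (ℤtoℚ pᵢ) (ℤtoℚ qᵢ) (ℤtoℚ p) (ℤtoℚ q) (ℤtoℚ pⱼ) (ℤtoℚ qⱼ)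
      where
      identity : ∀ c s pᵢ qᵢ p q pⱼ qⱼ →
        c * ((qⱼ - qᵢ) * p - (qⱼ - q) * pᵢ - (q - qᵢ) * pⱼ) ≡
        (qⱼ - q) * ((p * c + q * s) - (pᵢ * c + qᵢ * s)) + (q - qᵢ) * ((p * c + q * s) - (pⱼ * c + qⱼ * s))
      identity = ring-solve-∀ ℚ-ring

  -chord-excess≤ : ∀ {pᵢ qᵢ p q pⱼ qⱼ} → InStrip (pᵢ , qᵢ) → InStrip (p , q) → InStrip (pⱼ , qⱼ) →
    qᵢ ℤ.≤ q → q ℤ.≤ qⱼ → ℤ.- chord-excess (pᵢ , qᵢ) (p , q) (pⱼ , qⱼ) ℤ.≤ (qⱼ ℤ.- qᵢ) ℤ.* + slack
  -chord-excess≤ {pᵢ} {qᵢ} {p} {q} {pⱼ} {qⱼ} zᵢ∈ z∈ zⱼ∈ qᵢ≤q q≤qⱼ = ℤtoℚ-cancel-≤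
    (scaled-chord qᵢ≤q q≤qⱼ c*excess
      (along-diff≤ (pᵢ , qᵢ) (p , q) zᵢ∈ z∈) (along-diff≤ (pⱼ , qⱼ) (p , q) zⱼ∈ z∈))
    where
    c*excess : c * ℤtoℚ (ℤ.- chord-excess (pᵢ , qᵢ) (p , q) (pⱼ , qⱼ)) ≡
               ℤtoℚ (qⱼ ℤ.- q) * (along c s (pᵢ , qᵢ) - along c s (p , q)) +
               ℤtoℚ (q ℤ.- qᵢ) * (along c s (pⱼ , qⱼ) - along c s (p , q))
    c*excess rewrite ℤtoℚ-neg (chord-excess (pᵢ , qᵢ) (p , q) (pⱼ , qⱼ))
                   | ℤtoℚ-chord-excess pᵢ qᵢ p q pⱼ qⱼ | ℤtoℚ-- qⱼ q | ℤtoℚ-- q qᵢ =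
      identity c s (ℤtoℚ pᵢ) (ℤtoℚ qᵢ) (ℤtoℚ p) (ℤtoℚ q) (ℤtoℚ pⱼ) (ℤtoℚ qⱼ)
      where
      identity : ∀ c s pᵢ qᵢ p q pⱼ qⱼ →
        c * - ((qⱼ - qᵢ) * p - (qⱼ - q) * pᵢ - (q - qᵢ) * pⱼ) ≡
        (qⱼ - q) * ((pᵢ * c + qᵢ * s) - (p * c + q * s)) + (q - qᵢ) * ((pⱼ * c + qⱼ * s) - (p * c + q * s))
      identity = ring-solve-∀ ℚ-ring

  0<c : 0ℚ < c
  0<c = ℚ.≰⇒> λ c≤0 → 1≰0 (ℚ.≤-trans 1≤gc (subst (ℤtoℚ (+ g) * c ≤_) (ℚ.*-zeroʳ (ℤtoℚ (+ g)))
    (ℚ.*-monoˡ-≤-nonNeg (ℤtoℚ (+ g)) {{ℚ.nonNegative (0≤ℤtoℚ+ g)}} c≤0)))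
    where
    1≰0 : ¬ (1ℚ ≤ 0ℚ)
    1≰0 (*≤* (ℤ.+≤+ ()))

  extent : ℕ
  extent = ℤ.∣ a ∣ ℕ.+ ℤ.∣ b ∣ ℕ.+ ℤ.∣ e ∣

  κ : ℚ
  κ = ℤtoℚ (+ extent)

  0≤κ : 0ℚ ≤ κ
  0≤κ = 0≤ℤtoℚ+ extent

  -κ≤ : ∀ {x} → ℤ.∣ x ∣ ℕ.≤ extent → - κ ≤ ℤtoℚ x
  -κ≤ {x} ∣x∣≤ = subst (_≤ ℤtoℚ x) (ℤtoℚ-neg (+ extent))
    (ℤtoℚ-mono-≤ {ℤ.- + extent} {x} (proj₁ (∣i∣≤n⇒-n≤i≤n {x} ∣x∣≤)))

  ≤κ : ∀ {x} → ℤ.∣ x ∣ ℕ.≤ extent → ℤtoℚ x ≤ κ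
  ≤κ {x} ∣x∣≤ = ℤtoℚ-mono-≤ {x} {+ extent} (proj₂ (∣i∣≤n⇒-n≤i≤n {x} ∣x∣≤))

  ∣a∣≤extent : ℤ.∣ a ∣ ℕ.≤ extent
  ∣a∣≤extent = ℕ.≤-trans (ℕ.m≤m+n ℤ.∣ a ∣ ℤ.∣ b ∣) (ℕ.m≤m+n _ ℤ.∣ e ∣)

  ∣b∣≤extent : ℤ.∣ b ∣ ℕ.≤ extent
  ∣b∣≤extent = ℕ.≤-trans (ℕ.m≤n+m ℤ.∣ b ∣ ℤ.∣ a ∣) (ℕ.m≤m+n _ ℤ.∣ e ∣)

  ∣e∣≤extent : ℤ.∣ e ∣ ℕ.≤ extent
  ∣e∣≤extent = ℕ.m≤n+m ℤ.∣ e ∣ _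

  ∣along∣≤κ : ∀ z → InStrip z → ∣ along c s z ∣ ≤ κ
  ∣along∣≤κ z (a≤ , ≤b , _) = ∣p∣≤q (ℚ.≤-trans (-κ≤ {a} ∣a∣≤extent) a≤) (ℚ.≤-trans ≤b (≤κ {b} ∣b∣≤extent))

  -- q (c² + s²) = c · across + s · along, where across ≥ e and ∣ along ∣ ≤ κ.
  ordinate-bounded-below : ∀ {p q} → InStrip (p , q) → ℤ.- q ℤ.≤ + (g ℕ.* (extent ℕ.+ extent))
  ordinate-bounded-below {p} {q} z∈@(_ , _ , e≤) = ℤtoℚ-cancel-≤ (begin
    ℤtoℚ (ℤ.- q)
      ≤⟨ ≤-scale (ℚ.+-mono-≤ 0≤κ 0≤κ) (c*u≤2κ 0<c (ℚ.0≤∣p∣ s) 0≤κ u[c²+t²]≤) ⟩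
    ℤtoℚ (+ g) * (κ + κ)
      ≡⟨ cong (ℤtoℚ (+ g) *_) (sym (ℤtoℚ-pos-+ extent extent)) ⟩
    ℤtoℚ (+ g) * ℤtoℚ (+ (extent ℕ.+ extent))
      ≡⟨ sym (ℤtoℚ-pos-* g _) ⟩
    ℤtoℚ (+ (g ℕ.* (extent ℕ.+ extent))) ∎)
    where
    open ℚ.≤-Reasoning
    t u : ℚ
    t = ∣ s ∣
    u = ℤtoℚ (ℤ.- q)
    -c*across≤ : - (c * across c s (p , q)) ≤ c * κ
    -c*across≤ = subst (- (c * across c s (p , q)) ≤_)
      (trans (cong -_ (sym (ℚ.neg-distribʳ-* c κ))) (neg-involutive (c * κ)))
      (ℚ.neg-antimono-≤ (ℚ.*-monoˡ-≤-nonNeg c {{ℚ.nonNegative (ℚ.<⇒≤ 0<c)}}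
        (ℚ.≤-trans (-κ≤ {e} ∣e∣≤extent) e≤)))
    -s*along≤ : - (s * along c s (p , q)) ≤ t * κ
    -s*along≤ = begin
      - (s * along c s (p , q))   ≤⟨ -p≤∣p∣ _ ⟩
      ∣ s * along c s (p , q) ∣   ≡⟨ ℚ.∣p*q∣≡∣p∣*∣q∣ s _ ⟩
      t * ∣ along c s (p , q) ∣   ≤⟨ ℚ.*-monoˡ-≤-nonNeg t {{ℚ.nonNegative (ℚ.0≤∣p∣ s)}} (∣along∣≤κ (p , q) z∈) ⟩
      t * κ                       ∎
    u[c²+t²]≤ : u * (c * c + t * t) ≤ (c + t) * κ
    u[c²+t²]≤ = begin
      u * (c * c + t * t)                                     ≡⟨ cong (λ x → u * (c * c + x)) (∣p∣*∣p∣≡p*p s) ⟩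
      u * (c * c + s * s)                                     ≡⟨ -ordinate-in-frame ⟩
      - (c * across c s (p , q)) + - (s * along c s (p , q))   ≤⟨ ℚ.+-mono-≤ -c*across≤ -s*along≤ ⟩
      c * κ + t * κ                                           ≡⟨ sym (ℚ.*-distribʳ-+ κ c t) ⟩
      (c + t) * κ                                             ∎
      where
      -ordinate-in-frame : ℤtoℚ (ℤ.- q) * (c * c + s * s) ≡ - (c * across c s (p , q)) + - (s * along c s (p , q))
      -ordinate-in-frame rewrite ℤtoℚ-neg q | ℤtoℚ-neg p = identity c s (ℤtoℚ p) (ℤtoℚ q)
        where
        identity : ∀ c s p q → - q * (c * c + s * s) ≡ - (c * (q * c + - p * s)) + - (s * (p * c + q * s))
        identity = ring-solve-∀ ℚ-ring

  abscissa-bounded : ∀ {p q σ Q} → InStrip (p , q) → ∣ s ∣ ≤ ℤtoℚ (+ σ) → ℤ.∣ q ∣ ℕ.≤ Q →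
                     ℤ.∣ p ∣ ℕ.≤ g ℕ.* (extent ℕ.+ Q ℕ.* σ)
  abscissa-bounded {p} {q} {σ} {Q} z∈ ∣s∣≤σ ∣q∣≤Q =
    -n≤i≤n⇒∣i∣≤n (subst (ℤ.- + N ℤ.≤_) (ℤ.neg-involutive p) (ℤ.neg-mono-≤ -p≤N)) p≤N
    where
    open ℚ.≤-Reasoning
    M : ℚ
    M = κ + ℤtoℚ (+ Q) * ℤtoℚ (+ σ)
    N : ℕ
    N = g ℕ.* (extent ℕ.+ Q ℕ.* σ)
    0≤M : 0ℚ ≤ M
    0≤M = ℚ.+-mono-≤ 0≤κ (0≤p*q (0≤ℤtoℚ+ Q) (0≤ℤtoℚ+ σ))
    ∣q∣≤Q′ : ∣ ℤtoℚ q ∣ ≤ ℤtoℚ (+ Q)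
    ∣q∣≤Q′ = ∣p∣≤q
      (subst (_≤ ℤtoℚ q) (ℤtoℚ-neg (+ Q)) (ℤtoℚ-mono-≤ {ℤ.- + Q} {q} (proj₁ (∣i∣≤n⇒-n≤i≤n {q} ∣q∣≤Q))))
      (ℤtoℚ-mono-≤ {q} {+ Q} (proj₂ (∣i∣≤n⇒-n≤i≤n {q} ∣q∣≤Q)))
    ∣c*p∣≤M : ∣ c * ℤtoℚ p ∣ ≤ M
    ∣c*p∣≤M = begin
      ∣ c * ℤtoℚ p ∣                               ≡⟨ cong ∣_∣ (c*p≡ c s (ℤtoℚ p) (ℤtoℚ q)) ⟩
      ∣ along c s (p , q) - ℤtoℚ q * s ∣           ≤⟨ ℚ.∣p-q∣≤∣p∣+∣q∣ (along c s (p , q)) (ℤtoℚ q * s) ⟩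
      ∣ along c s (p , q) ∣ + ∣ ℤtoℚ q * s ∣
        ≡⟨ cong (_+_ ∣ along c s (p , q) ∣) (ℚ.∣p*q∣≡∣p∣*∣q∣ (ℤtoℚ q) s) ⟩
      ∣ along c s (p , q) ∣ + ∣ ℤtoℚ q ∣ * ∣ s ∣   ≤⟨ ℚ.+-mono-≤ (∣along∣≤κ (p , q) z∈) ∣q∣∣s∣≤ ⟩
      M                                            ∎
      where
      c*p≡ : ∀ c s p q → c * p ≡ p * c + q * s - q * s
      c*p≡ = ring-solve-∀ ℚ-ring
      ∣q∣∣s∣≤ : ∣ ℤtoℚ q ∣ * ∣ s ∣ ≤ ℤtoℚ (+ Q) * ℤtoℚ (+ σ)
      ∣q∣∣s∣≤ = ℚ.≤-trans (ℚ.*-monoʳ-≤-nonNeg ∣ s ∣ {{ℚ.nonNegative (ℚ.0≤∣p∣ s)}} ∣q∣≤Q′)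
                          (ℚ.*-monoˡ-≤-nonNeg (ℤtoℚ (+ Q)) {{ℚ.nonNegative (0≤ℤtoℚ+ Q)}} ∣s∣≤σ)
    gM≡N : ℤtoℚ (+ g) * M ≡ ℤtoℚ (+ N)
    gM≡N = sym (trans (ℤtoℚ-pos-* g _) (cong (ℤtoℚ (+ g) *_)
             (trans (ℤtoℚ-pos-+ extent _) (cong (_+_ κ) (ℤtoℚ-pos-* Q σ)))))
    p≤N : p ℤ.≤ + N
    p≤N = ℤtoℚ-cancel-≤ (subst (ℤtoℚ p ≤_) gM≡N (≤-scale 0≤M (ℚ.≤-trans (p≤∣p∣ _) ∣c*p∣≤M)))
    -p≤N : ℤ.- p ℤ.≤ + N
    -p≤N = ℤtoℚ-cancel-≤ (subst₂ _≤_ (sym (ℤtoℚ-neg p)) gM≡N (≤-scale 0≤M (begin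
      c * - ℤtoℚ p     ≡⟨ sym (ℚ.neg-distribʳ-* c (ℤtoℚ p)) ⟩
      - (c * ℤtoℚ p)   ≤⟨ -p≤∣p∣ (c * ℤtoℚ p) ⟩
      ∣ c * ℤtoℚ p ∣   ≤⟨ ∣c*p∣≤M ⟩
      M                ∎)))

turn-strip : HalfStrip → HalfStrip
turn-strip H = record
  { c = negℝ s ; s = c ; w≢0 = Sum.map₁ (NonZeroℝ-neg {s}) (Sum.swap w≢0)
  ; a = a ; b = b ; e = e ; a<b = a<b }
  where open HalfStrip H

LinGE-resp : ∀ {a p q c s p′ q′ c′ s′} → (∀ n → approx p′ q′ c′ s′ n ≡ approx p q c s n) →
             ℤ.∣ p′ ∣ ℕ.+ ℤ.∣ q′ ∣ ≡ ℤ.∣ p ∣ ℕ.+ ℤ.∣ q ∣ → LinGE a p q c s → LinGE a p′ q′ c′ s′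
LinGE-resp {a} approx≡ size≡ h n =
  subst₂ (λ x k → ℤtoℚ a ≤ x + + k / suc n) (sym (approx≡ n)) (sym size≡) (h n)

LinLE-resp : ∀ {b p q c s p′ q′ c′ s′} → (∀ n → approx p′ q′ c′ s′ n ≡ approx p q c s n) →
             ℤ.∣ p′ ∣ ℕ.+ ℤ.∣ q′ ∣ ≡ ℤ.∣ p ∣ ℕ.+ ℤ.∣ q ∣ → LinLE b p q c s → LinLE b p′ q′ c′ s′
LinLE-resp {b} approx≡ size≡ h n =
  subst₂ (λ x k → x ≤ ℤtoℚ b + + k / suc n) (sym (approx≡ n)) (sym size≡) (h n)

InHalfStrip-turn : ∀ H {z} → InHalfStrip H z → InHalfStrip (turn-strip H) (turn z)
InHalfStrip-turn H {p , q} (a≤ , ≤b , e≤) =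
  LinGE-resp {a} {p} {q} {c} {s} {ℤ.- q} {p} {negℝ s} {c} along≡ size≡ a≤ ,
  LinLE-resp {b} {p} {q} {c} {s} {ℤ.- q} {p} {negℝ s} {c} along≡ size≡ ≤b ,
  LinGE-resp {e} {q} {ℤ.- p} {c} {s} {p} {ℤ.- (ℤ.- q)} {negℝ s} {c} across≡ size′≡ e≤
  where
  open HalfStrip H
  along≡ : ∀ n → approx (ℤ.- q) p (negℝ s) c n ≡ approx p q c s n
  along≡ n rewrite ℤtoℚ-neg q = identity (ℤtoℚ p) (ℤtoℚ q) (seq c n) (seq s n)
    where
    identity : ∀ p q c s → - q * - s + p * c ≡ p * c + q * s
    identity = ring-solve-∀ ℚ-ring
  across≡ : ∀ n → approx p (ℤ.- (ℤ.- q)) (negℝ s) c n ≡ approx q (ℤ.- p) c s n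
  across≡ n rewrite ℤ.neg-involutive q | ℤtoℚ-neg p = identity (ℤtoℚ p) (ℤtoℚ q) (seq c n) (seq s n)
    where
    identity : ∀ p q c s → p * - s + q * c ≡ q * c + - p * s
    identity = ring-solve-∀ ℚ-ring
  size≡ : ℤ.∣ ℤ.- q ∣ ℕ.+ ℤ.∣ p ∣ ≡ ℤ.∣ p ∣ ℕ.+ ℤ.∣ q ∣
  size≡ = trans (cong (ℕ._+ ℤ.∣ p ∣) (ℤ.∣-i∣≡∣i∣ q)) (ℕ.+-comm ℤ.∣ q ∣ ℤ.∣ p ∣)
  size′≡ : ℤ.∣ p ∣ ℕ.+ ℤ.∣ ℤ.- (ℤ.- q) ∣ ≡ ℤ.∣ q ∣ ℕ.+ ℤ.∣ ℤ.- p ∣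
  size′≡ rewrite ℤ.neg-involutive q | ℤ.∣-i∣≡∣i∣ p = ℕ.+-comm ℤ.∣ p ∣ ℤ.∣ q ∣

turn-strips : ℕ → HalfStrip → HalfStrip
turn-strips zero    H = H
turn-strips (suc k) H = turn-strip (turn-strips k H)

InHalfStrip-rotate : ∀ k H {z} → InHalfStrip H z → InHalfStrip (turn-strips k H) (rotate k z)
InHalfStrip-rotate zero    H z∈H = z∈H
InHalfStrip-rotate (suc k) H {z} z∈H =
  InHalfStrip-turn (turn-strips k H) {rotate k z} (InHalfStrip-rotate k H z∈H)

-- c is apart from 0 and positive, so the axis (- s , c) of the half-strip points upward.
PointsUp : HalfStrip → Set
PointsUp H = ∃ λ m → 1/[1+ m ] < seq (HalfStrip.c H) m

turn-upward : ∀ H → ∃ λ k → PointsUp (turn-strips k H)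
turn-upward H with HalfStrip.w≢0 H
... | inj₁ (m , apart) with ℚ.∣p∣≡p∨∣p∣≡-p (seq (HalfStrip.c H) m)
...   | inj₁ ∣c∣≡c  = 0 , m , subst (1/[1+ m ] <_) ∣c∣≡c apart
...   | inj₂ ∣c∣≡-c = 2 , m , subst (1/[1+ m ] <_) ∣c∣≡-c apart
turn-upward H | inj₂ (m , apart) with ℚ.∣p∣≡p∨∣p∣≡-p (seq (HalfStrip.s H) m)
...   | inj₁ ∣s∣≡s  = 3 , m , subst (1/[1+ m ] <_) (trans ∣s∣≡s (sym (neg-involutive _))) apart
...   | inj₂ ∣s∣≡-s = 1 , m , subst (1/[1+ m ] <_) ∣s∣≡-s apart

-- Upward strips

record UpwardStrip (S : Pt → Set) : Set where
  field
    slack : ℕ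
    ≤-right-column : ∀ {pᵢ qᵢ p q pⱼ qⱼ x} → S (pᵢ , qᵢ) → S (p , q) → S (pⱼ , qⱼ) →
      qᵢ ℤ.< qⱼ → qᵢ ℤ.≤ q → q ℤ.≤ qⱼ → pᵢ ℤ.≤ x → pⱼ ℤ.≤ x → p ℤ.≤ x ℤ.+ + slack
    left-column-≤ : ∀ {pᵢ qᵢ p q pⱼ qⱼ x} → S (pᵢ , qᵢ) → S (p , q) → S (pⱼ , qⱼ) →
      qᵢ ℤ.< qⱼ → qᵢ ℤ.≤ q → q ℤ.≤ qⱼ → x ℤ.≤ pᵢ → x ℤ.≤ pⱼ → x ℤ.- + slack ℤ.≤ p
    bounded-below : ∀ T → ∃ λ N → ∀ {p q} → S (p , q) → q ℤ.≤ T → ℤ.∣ p ∣ ℕ.≤ N × ℤ.∣ q ∣ ℕ.≤ N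

chord-excess⇒≤-right-column : ∀ {pᵢ qᵢ p q pⱼ qⱼ x d} → qᵢ ℤ.< qⱼ → qᵢ ℤ.≤ q → q ℤ.≤ qⱼ →
  pᵢ ℤ.≤ x → pⱼ ℤ.≤ x → chord-excess (pᵢ , qᵢ) (p , q) (pⱼ , qⱼ) ℤ.≤ (qⱼ ℤ.- qᵢ) ℤ.* d →
  p ℤ.≤ x ℤ.+ d
chord-excess⇒≤-right-column {pᵢ} {qᵢ} {p} {q} {pⱼ} {qⱼ} {x} {d} qᵢ<qⱼ qᵢ≤q q≤qⱼ pᵢ≤x pⱼ≤x excess≤ =
  ℤ.*-cancelˡ-≤-pos p (x ℤ.+ d) (qⱼ ℤ.- qᵢ) {{ℤ.positive 0<qⱼ-qᵢ}} (begin
    (qⱼ ℤ.- qᵢ) ℤ.* p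
      ≡⟨ split pᵢ qᵢ p q pⱼ qⱼ ⟩
    chord-excess (pᵢ , qᵢ) (p , q) (pⱼ , qⱼ) ℤ.+ ((qⱼ ℤ.- q) ℤ.* pᵢ ℤ.+ (q ℤ.- qᵢ) ℤ.* pⱼ)
      ≤⟨ ℤ.+-mono-≤ excess≤ (ℤ.+-mono-≤ (weight-mono q≤qⱼ pᵢ≤x) (weight-mono qᵢ≤q pⱼ≤x)) ⟩
    (qⱼ ℤ.- qᵢ) ℤ.* d ℤ.+ ((qⱼ ℤ.- q) ℤ.* x ℤ.+ (q ℤ.- qᵢ) ℤ.* x)
      ≡⟨ merge qᵢ q qⱼ x d ⟩
    (qⱼ ℤ.- qᵢ) ℤ.* (x ℤ.+ d) ∎)
  where
  open ℤ.≤-Reasoning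
  weight-mono : ∀ {u v y z} → u ℤ.≤ v → y ℤ.≤ z → (v ℤ.- u) ℤ.* y ℤ.≤ (v ℤ.- u) ℤ.* z
  weight-mono {u} {v} u≤v = ℤ.*-monoˡ-≤-nonNeg (v ℤ.- u) {{ℤ.nonNegative (ℤ.i≤j⇒0≤j-i u≤v)}}
  0<qⱼ-qᵢ : + 0 ℤ.< qⱼ ℤ.- qᵢ
  0<qⱼ-qᵢ = subst (ℤ._< qⱼ ℤ.- qᵢ) (ℤ.+-inverseʳ qᵢ) (ℤ.+-monoˡ-< (ℤ.- qᵢ) qᵢ<qⱼ)
  split : ∀ pᵢ qᵢ p q pⱼ qⱼ → (qⱼ ℤ.- qᵢ) ℤ.* p ≡
    (qⱼ ℤ.- qᵢ) ℤ.* p ℤ.- (qⱼ ℤ.- q) ℤ.* pᵢ ℤ.- (q ℤ.- qᵢ) ℤ.* pⱼ ℤ.+ ((qⱼ ℤ.- q) ℤ.* pᵢ ℤ.+ (q ℤ.- qᵢ) ℤ.* pⱼ)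
  split = solve-∀
  merge : ∀ qᵢ q qⱼ x d → (qⱼ ℤ.- qᵢ) ℤ.* d ℤ.+ ((qⱼ ℤ.- q) ℤ.* x ℤ.+ (q ℤ.- qᵢ) ℤ.* x) ≡ (qⱼ ℤ.- qᵢ) ℤ.* (x ℤ.+ d)
  merge = solve-∀

chord-excess-reflect : ∀ pᵢ qᵢ p q pⱼ qⱼ →
  chord-excess (ℤ.- pᵢ , qᵢ) (ℤ.- p , q) (ℤ.- pⱼ , qⱼ) ≡ ℤ.- chord-excess (pᵢ , qᵢ) (p , q) (pⱼ , qⱼ)
chord-excess-reflect = identity
  where
  identity : ∀ pᵢ qᵢ p q pⱼ qⱼ →
    (qⱼ ℤ.- qᵢ) ℤ.* ℤ.- p ℤ.- (qⱼ ℤ.- q) ℤ.* ℤ.- pᵢ ℤ.- (q ℤ.- qᵢ) ℤ.* ℤ.- pⱼ ≡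
    ℤ.- ((qⱼ ℤ.- qᵢ) ℤ.* p ℤ.- (qⱼ ℤ.- q) ℤ.* pᵢ ℤ.- (q ℤ.- qᵢ) ℤ.* pⱼ)
  identity = solve-∀

module _ (H : HalfStrip) (points-up : PointsUp H) where
  open HalfStrip H

  private
    m g σ : ℕ
    m = proj₁ points-up
    g = proj₁ (eventually-bounded-below c m (proj₂ points-up))
    σ = proj₁ (seq-bounded s)

    1≤gc : ∀ n → g ℕ.≤ suc n → 1ℚ ≤ ℤtoℚ (+ g) * seq c n
    1≤gc = proj₂ (eventually-bounded-below c m (proj₂ points-up))

    ∣s∣≤σ : ∀ n → ∣ seq s n ∣ ≤ ℤtoℚ (+ σ)
    ∣s∣≤σ = proj₂ (seq-bounded s)

    size : Pt → ℕ
    size (p , q) = ℤ.∣ p ∣ ℕ.+ ℤ.∣ q ∣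

    ≤-suc-+ : ∀ {k} i j → k ℕ.≤ i → k ℕ.≤ suc (i ℕ.+ j)
    ≤-suc-+ i j k≤i = ℕ.≤-trans k≤i (ℕ.≤-trans (ℕ.m≤m+n i j) (ℕ.n≤1+n _))

    module Approx (n : ℕ) (g≤1+n : g ℕ.≤ suc n) =
      RatStripGeometry (seq c n) (seq s n) (a ℤ.- + 1) (b ℤ.+ + 1) (e ℤ.- + 1) g (1≤gc n g≤1+n)

    InStripAt : ℕ → Pt → Set
    InStripAt n = InRatStrip (seq c n) (seq s n) (a ℤ.- + 1) (b ℤ.+ + 1) (e ℤ.- + 1)

    fatten : ∀ z n → InHalfStrip H z → size z ℕ.≤ suc n → InStripAt n z
    fatten (p , q) n = InHalfStrip⇒InRatStrip H {p} {q} {n}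

    precision : Pt → Pt → Pt → ℕ
    precision zᵢ z zⱼ = size zᵢ ℕ.+ size z ℕ.+ size zⱼ ℕ.+ g

    module Chord (zᵢ z zⱼ : Pt) (zᵢ∈ : InHalfStrip H zᵢ) (z∈ : InHalfStrip H z) (zⱼ∈ : InHalfStrip H zⱼ) where
      n : ℕ
      n = precision zᵢ z zⱼ
      g≤1+n : g ℕ.≤ suc n
      g≤1+n = ℕ.≤-trans (ℕ.m≤n+m g (size zᵢ ℕ.+ size z ℕ.+ size zⱼ)) (ℕ.n≤1+n n)
      open Approx n g≤1+n public using (chord-excess≤; -chord-excess≤)
      zᵢ∈′ : InStripAt n zᵢ
      zᵢ∈′ = fatten zᵢ n zᵢ∈
        (≤-suc-+ _ g (ℕ.≤-trans (ℕ.m≤m+n (size zᵢ) (size z)) (ℕ.m≤m+n _ (size zⱼ))))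
      z∈′ : InStripAt n z
      z∈′ = fatten z n z∈
        (≤-suc-+ _ g (ℕ.≤-trans (ℕ.m≤n+m (size z) (size zᵢ)) (ℕ.m≤m+n _ (size zⱼ))))
      zⱼ∈′ : InStripAt n zⱼ
      zⱼ∈′ = fatten zⱼ n zⱼ∈ (≤-suc-+ _ g (ℕ.m≤n+m (size zⱼ) (size zᵢ ℕ.+ size z)))

  upward-strip : UpwardStrip (InHalfStrip H)
  upward-strip = record
    { slack          = slack
    ; ≤-right-column = right-column
    ; left-column-≤  = left-column
    ; bounded-below  = λ T → size-bound T , λ {p} {q} → below T {p} {q}
    }
    where
    slack : ℕ
    slack = g ℕ.* ℤ.∣ (b ℤ.+ + 1) ℤ.- (a ℤ.- + 1) ∣

    right-column : ∀ {pᵢ qᵢ p q pⱼ qⱼ x} → InHalfStrip H (pᵢ , qᵢ) → InHalfStrip H (p , q) →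
      InHalfStrip H (pⱼ , qⱼ) → qᵢ ℤ.< qⱼ → qᵢ ℤ.≤ q → q ℤ.≤ qⱼ → pᵢ ℤ.≤ x → pⱼ ℤ.≤ x →
      p ℤ.≤ x ℤ.+ + slack
    right-column {pᵢ} {qᵢ} {p} {q} {pⱼ} {qⱼ} zᵢ∈ z∈ zⱼ∈ qᵢ<qⱼ qᵢ≤q q≤qⱼ pᵢ≤x pⱼ≤x =
      chord-excess⇒≤-right-column qᵢ<qⱼ qᵢ≤q q≤qⱼ pᵢ≤x pⱼ≤x (chord-excess≤ zᵢ∈′ z∈′ zⱼ∈′ qᵢ≤q q≤qⱼ)
      where open Chord (pᵢ , qᵢ) (p , q) (pⱼ , qⱼ) zᵢ∈ z∈ zⱼ∈

    left-column : ∀ {pᵢ qᵢ p q pⱼ qⱼ x} → InHalfStrip H (pᵢ , qᵢ) → InHalfStrip H (p , q) →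
      InHalfStrip H (pⱼ , qⱼ) → qᵢ ℤ.< qⱼ → qᵢ ℤ.≤ q → q ℤ.≤ qⱼ → x ℤ.≤ pᵢ → x ℤ.≤ pⱼ →
      x ℤ.- + slack ℤ.≤ p
    left-column {pᵢ} {qᵢ} {p} {q} {pⱼ} {qⱼ} {x} zᵢ∈ z∈ zⱼ∈ qᵢ<qⱼ qᵢ≤q q≤qⱼ x≤pᵢ x≤pⱼ =
      subst₂ ℤ._≤_ (-[-x+d]≡x-d x (+ slack)) (ℤ.neg-involutive p) (ℤ.neg-mono-≤ -p≤-x+slack)
      where
      open Chord (pᵢ , qᵢ) (p , q) (pⱼ , qⱼ) zᵢ∈ z∈ zⱼ∈
      -[-x+d]≡x-d : ∀ x d → ℤ.- (ℤ.- x ℤ.+ d) ≡ x ℤ.- d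
      -[-x+d]≡x-d = solve-∀
      -p≤-x+slack : ℤ.- p ℤ.≤ ℤ.- x ℤ.+ + slack
      -p≤-x+slack = chord-excess⇒≤-right-column qᵢ<qⱼ qᵢ≤q q≤qⱼ (ℤ.neg-mono-≤ x≤pᵢ) (ℤ.neg-mono-≤ x≤pⱼ)
        (subst (ℤ._≤ (qⱼ ℤ.- qᵢ) ℤ.* + slack) (sym (chord-excess-reflect pᵢ qᵢ p q pⱼ qⱼ))
          (-chord-excess≤ zᵢ∈′ z∈′ zⱼ∈′ qᵢ≤q q≤qⱼ))

    extent depth : ℕ
    extent = ℤ.∣ a ℤ.- + 1 ∣ ℕ.+ ℤ.∣ b ℤ.+ + 1 ∣ ℕ.+ ℤ.∣ e ℤ.- + 1 ∣
    depth  = g ℕ.* (extent ℕ.+ extent)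

    ordinate-bound size-bound : ℤ → ℕ
    ordinate-bound T = depth ℕ.+ ℤ.∣ T ∣
    size-bound T = g ℕ.* (extent ℕ.+ ordinate-bound T ℕ.* σ) ℕ.+ ordinate-bound T

    below : ∀ T {p q} → InHalfStrip H (p , q) → q ℤ.≤ T →
            ℤ.∣ p ∣ ℕ.≤ size-bound T × ℤ.∣ q ∣ ℕ.≤ size-bound T
    below T {p} {q} z∈ q≤T =
      ℕ.≤-trans (abscissa-bounded {p} {q} {σ} {Q} z∈′ (∣s∣≤σ n) ∣q∣≤Q) (ℕ.m≤m+n _ Q) ,
      ℕ.≤-trans ∣q∣≤Q (ℕ.m≤n+m Q (g ℕ.* (extent ℕ.+ Q ℕ.* σ)))
      where
      Q n : ℕ
      Q = ordinate-bound T
      n = size (p , q) ℕ.+ g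
      g≤1+n : g ℕ.≤ suc n
      g≤1+n = ℕ.≤-trans (ℕ.m≤n+m g (size (p , q))) (ℕ.n≤1+n n)
      open Approx n g≤1+n using (ordinate-bounded-below; abscissa-bounded)
      z∈′ : InStripAt n (p , q)
      z∈′ = fatten (p , q) n z∈ (≤-suc-+ (size (p , q)) g ℕ.≤-refl)
      -depth≤q : ℤ.- + depth ℤ.≤ q
      -depth≤q = subst (ℤ.- + depth ℤ.≤_) (ℤ.neg-involutive q)
                       (ℤ.neg-mono-≤ (ordinate-bounded-below {p} {q} z∈′))
      ∣q∣≤Q : ℤ.∣ q ∣ ℕ.≤ Q
      ∣q∣≤Q = -n≤i≤n⇒∣i∣≤n (ℤ.≤-trans (ℤ.neg-mono-≤ (+≤+ (ℕ.m≤m+n depth ℤ.∣ T ∣))) -depth≤q)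
                           (ℤ.≤-trans q≤T (ℤ.≤-trans (i≤+∣i∣ T) (+≤+ (ℕ.m≤n+m ℤ.∣ T ∣ depth))))

module _ (P : InfSimplePath) where

  taxicab-path : ∀ i l → taxicab (vert P i) (vert P (i ℕ.+ l)) ℕ.≤ l
  taxicab-path i zero rewrite ℕ.+-identityʳ i | taxicab-self (vert P i) = z≤n
  taxicab-path i (suc l) rewrite ℕ.+-suc i l = ℕ.≤-trans
    (taxicab-triangle (vert P i) (vert P (i ℕ.+ l)) (vert P (suc (i ℕ.+ l))))
    (subst (λ d → taxicab (vert P i) (vert P (i ℕ.+ l)) ℕ.+ d ℕ.≤ suc l) (sym (step P (i ℕ.+ l)))
           (ℕ.≤-trans (ℕ.+-monoˡ-≤ 1 (taxicab-path i l)) (ℕ.≤-reflexive (ℕ.+-comm l 1))))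

  row-step : ∀ n → row (vert P (suc n)) ℤ.≤ row (vert P n) ℤ.+ + 1
  row-step n = Adj⇒row-step (vert P n) (vert P (suc n)) (step P n)

escapes : ∀ {S} → UpwardStrip S → (P : InfSimplePath) → (∀ n → S (vert P n)) →
          ∀ T → ∃ λ k → T ℤ.≤ row (vert P k)
escapes strip P P⊆S T = search (any? (λ k → T ℤ.≤? row (vert P k)) ks)
  where
  N : ℕ
  N = proj₁ (UpwardStrip.bounded-below strip T)
  ks : List ℕ
  ks = upTo (suc (length (box N)))
  search : Dec (Any (λ k → T ℤ.≤ row (vert P k)) ks) → ∃ λ k → T ℤ.≤ row (vert P k)
  search (yes found) = Any.satisfied found
  search (no none) = ⊥-elim (ℕ.<-irrefl refl (begin-strict
    length (box N)             <⟨ ℕ.n<1+n _ ⟩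
    suc (length (box N))       ≡⟨ sym (trans (length-map (vert P) ks) (length-upTo _)) ⟩
    length (map (vert P) ks)   ≤⟨ Unique-⊆⇒length≤ (Unique.map⁺ (simple P _ _) (Unique.upTo⁺ _)) visited⊆box ⟩
    length (box N)             ∎))
    where
    open ℕ.≤-Reasoning
    visited⊆box : map (vert P) ks ⊆ box N
    visited⊆box z∈ with ∈-map⁻ (vert P) z∈
    ... | k , k∈ , refl =
      let (∣p∣≤N , ∣q∣≤N) = proj₂ (UpwardStrip.bounded-below strip T) (P⊆S k)
                              (ℤ.<⇒≤ (ℤ.≰⇒> λ T≤ → none (lose k∈ T≤)))
      in ∈-box N (∣∣≤⇒∈-range N ∣p∣≤N) (∣∣≤⇒∈-range N ∣q∣≤N)

record Crossing (P : InfSimplePath) (t₀ : ℤ) (h : ℕ) : Set where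
  field
    start len : ℕ
    start-row : row (vert P start) ≡ t₀
    end-row   : row (vert P (start ℕ.+ len)) ≡ t₀ ℤ.+ + h
    in-band   : ∀ r → r ℕ.≤ len → t₀ ℤ.≤ row (vert P (start ℕ.+ r)) × row (vert P (start ℕ.+ r)) ℤ.≤ t₀ ℤ.+ + h

  segment : List Pt
  segment = map (λ r → vert P (start ℕ.+ r)) (upTo (suc len))

  length-segment : length segment ≡ suc len
  length-segment = trans (length-map _ (upTo (suc len))) (length-upTo (suc len))

  segment-Unique : Unique segment
  segment-Unique = Unique.map⁺ (λ e → ℕ.+-cancelˡ-≡ start _ _ (simple P _ _ e)) (Unique.upTo⁺ (suc len))

  ∈-segment : ∀ {z} → z ∈ segment → ∃ λ r → r ℕ.≤ len × z ≡ vert P (start ℕ.+ r)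
  ∈-segment z∈ with ∈-map⁻ _ z∈
  ... | r , r∈ , z≡ = r , ℕ.≤-pred (∈-upTo⁻ r∈) , z≡

  crossing-length : ℤ.∣ proj₁ (vert P start) ℤ.- proj₁ (vert P (start ℕ.+ len)) ∣ ℕ.+ h ℕ.≤ len
  crossing-length = subst (ℕ._≤ len) (cong (_ ℕ.+_) rows-apart) (taxicab-path P start len)
    where
    i-[i+j]≡-j : ∀ i j → i ℤ.- (i ℤ.+ j) ≡ ℤ.- j
    i-[i+j]≡-j = solve-∀
    rows-apart : ℤ.∣ row (vert P start) ℤ.- row (vert P (start ℕ.+ len)) ∣ ≡ h
    rows-apart = begin
      ℤ.∣ row (vert P start) ℤ.- row (vert P (start ℕ.+ len)) ∣
        ≡⟨ cong₂ (λ x y → ℤ.∣ x ℤ.- y ∣) start-row end-row ⟩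
      ℤ.∣ t₀ ℤ.- (t₀ ℤ.+ + h) ∣
        ≡⟨ cong ℤ.∣_∣ (i-[i+j]≡-j t₀ (+ h)) ⟩
      ℤ.∣ ℤ.- + h ∣
        ≡⟨ ℤ.∣-i∣≡∣i∣ (+ h) ⟩
      h ∎
      where open ≡-Reasoning

crosses : ∀ {S} → UpwardStrip S → (P : InfSimplePath) → (∀ n → S (vert P n)) →
          ∀ {t₀} → row (vert P 0) ℤ.≤ t₀ → ∀ h → Crossing P t₀ h
crosses strip P P⊆S {t₀} start≤t₀ h =
  let (k , t₁≤) = escapes strip P P⊆S (t₀ ℤ.+ + h)
      (i , l , start-row , end-row , in-band) =
        crossing (row ∘ vert P) (row-step P) start≤t₀ (ℤ.i≤i+j t₀ (+ h)) t₁≤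
  in record { start = i ; len = l ; start-row = start-row ; end-row = end-row ; in-band = in-band }

-- Two disjoint paths

band-too-short : ∀ {Δ h d l l′} → Δ ℕ.+ h ℕ.≤ l → h ℕ.≤ l′ →
  suc l ℕ.+ suc l′ ℕ.≤ 2 ℕ.+ (Δ ℕ.+ d ℕ.+ h) → h ℕ.≤ d
band-too-short {Δ} {h} {d} {l} {l′} Δ+h≤l h≤l′ count≤ =
  ℕ.+-cancelˡ-≤ Δ h d (ℕ.+-cancelʳ-≤ h (Δ ℕ.+ h) (Δ ℕ.+ d) (begin
    Δ ℕ.+ h ℕ.+ h      ≤⟨ ℕ.+-mono-≤ Δ+h≤l h≤l′ ⟩
    l ℕ.+ l′           ≤⟨ ℕ.+-cancelˡ-≤ 2 _ _ (subst (ℕ._≤ 2 ℕ.+ (Δ ℕ.+ d ℕ.+ h)) 2+l+l′ count≤) ⟩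
    Δ ℕ.+ d ℕ.+ h      ∎))
  where
  open ℕ.≤-Reasoning
  2+l+l′ : suc l ℕ.+ suc l′ ≡ 2 ℕ.+ (l ℕ.+ l′)
  2+l+l′ = cong suc (ℕ.+-suc l l′)

disjoint-crossings-impossible : ∀ {S Good} (strip : UpwardStrip S) → RectangleBound Good →
  ∀ {P Q t₀} → (∀ n → Good (vert P n) × S (vert P n)) → (∀ n → Good (vert Q n) × S (vert Q n)) →
  (∀ m n → vert P m ≢ vert Q n) →
  let h = suc (UpwardStrip.slack strip ℕ.+ UpwardStrip.slack strip) in Crossing P t₀ h → Crossing Q t₀ h → ⊥
disjoint-crossings-impossible {S} {Good} strip bound {P} {Q} {t₀} P∈ Q∈ disjoint CP CQ =
  ℕ.<-irrefl refl (band-too-short (Crossing.crossing-length CP)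
    (ℕ.≤-trans (ℕ.m≤n+m h _) (Crossing.crossing-length CQ)) count≤)
  where
  open UpwardStrip strip
  open Crossing CP using (start; len; start-row; end-row)
  h : ℕ
  h = suc (slack ℕ.+ slack)
  zᵢ zⱼ : Pt
  zᵢ = vert P start
  zⱼ = vert P (start ℕ.+ len)
  lo : ℤ
  lo = proj₁ zᵢ ℤ.⊓ proj₁ zⱼ
  Δ : ℕ
  Δ = ℤ.∣ proj₁ zᵢ ℤ.- proj₁ zⱼ ∣
  R : Rect
  R = rect (lo ℤ.- + slack) t₀ (Δ ℕ.+ (slack ℕ.+ slack)) h
  band⊆R : ∀ {z} → S z → t₀ ℤ.≤ row z → row z ℤ.≤ t₀ ℤ.+ + h → InRect R z
  band⊆R {p , q} z∈S t₀≤q q≤t₁ = (lo-slack≤p , p≤lo+width) , (t₀≤q , q≤t₁)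
    where
    zᵢ∈S : S zᵢ
    zᵢ∈S = proj₂ (P∈ start)
    zⱼ∈S : S zⱼ
    zⱼ∈S = proj₂ (P∈ (start ℕ.+ len))
    qᵢ≤q : row zᵢ ℤ.≤ q
    qᵢ≤q = subst (ℤ._≤ q) (sym start-row) t₀≤q
    q≤qⱼ : q ℤ.≤ row zⱼ
    q≤qⱼ = subst (q ℤ.≤_) (sym end-row) q≤t₁
    qᵢ<qⱼ : row zᵢ ℤ.< row zⱼ
    qᵢ<qⱼ = subst₂ ℤ._<_ (trans (ℤ.+-identityʳ t₀) (sym start-row)) (sym end-row)
                          (ℤ.+-monoʳ-< t₀ (ℤ.+<+ (s≤s z≤n)))
    lo-slack≤p : lo ℤ.- + slack ℤ.≤ p
    lo-slack≤p = left-column-≤ zᵢ∈S z∈S zⱼ∈S qᵢ<qⱼ qᵢ≤q q≤qⱼ (ℤ.i⊓j≤i _ _) (ℤ.i⊓j≤j _ _)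
    hi : ℤ
    hi = lo ℤ.+ + Δ
    pᵢ≤hi : proj₁ zᵢ ℤ.≤ hi
    pᵢ≤hi = subst (proj₁ zᵢ ℤ.≤_) (sym (⊓+∣-∣≡⊔ (proj₁ zᵢ) (proj₁ zⱼ))) (ℤ.i≤i⊔j _ _)
    pⱼ≤hi : proj₁ zⱼ ℤ.≤ hi
    pⱼ≤hi = subst (proj₁ zⱼ ℤ.≤_) (sym (⊓+∣-∣≡⊔ (proj₁ zᵢ) (proj₁ zⱼ))) (ℤ.i≤j⊔i _ _)
    p≤lo+width : p ℤ.≤ lo ℤ.- + slack ℤ.+ + (Δ ℕ.+ (slack ℕ.+ slack))
    p≤lo+width = subst (p ℤ.≤_) (regroup lo Δ slack)
      (≤-right-column zᵢ∈S z∈S zⱼ∈S qᵢ<qⱼ qᵢ≤q q≤qⱼ pᵢ≤hi pⱼ≤hi)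
      where
      regroup : ∀ x Δ d → x ℤ.+ + Δ ℤ.+ + d ≡ x ℤ.- + d ℤ.+ + (Δ ℕ.+ (d ℕ.+ d))
      regroup x Δ d rewrite ℤ.pos-+ Δ (d ℕ.+ d) | ℤ.pos-+ d d = identity x (+ Δ) (+ d)
        where
        identity : ∀ x Δ d → x ℤ.+ Δ ℤ.+ d ≡ x ℤ.- d ℤ.+ (Δ ℤ.+ (d ℤ.+ d))
        identity = solve-∀
  zs : List Pt
  zs = Crossing.segment CP ++ Crossing.segment CQ
  zs-Unique : Unique zs
  zs-Unique = Unique.++⁺ (Crossing.segment-Unique CP) (Crossing.segment-Unique CQ) apart
    where
    apart : ∀ {z} → ¬ (z ∈ Crossing.segment CP × z ∈ Crossing.segment CQ)
    apart (z∈P , z∈Q) with Crossing.∈-segment CP z∈P | Crossing.∈-segment CQ z∈Q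
    ... | _ , _ , z≡Pm | _ , _ , z≡Qn = disjoint _ _ (trans (sym z≡Pm) z≡Qn)
  zs-good : All (λ z → Good z × InRect R z) zs
  zs-good = All.tabulate λ z∈ → Sum.[ from CP P∈ , from CQ Q∈ ] (∈-++⁻ (Crossing.segment CP) z∈)
    where
    from : ∀ {P′} (C : Crossing P′ t₀ h) → (∀ n → Good (vert P′ n) × S (vert P′ n)) →
           ∀ {z} → z ∈ Crossing.segment C → Good z × InRect R z
    from C P′∈ z∈ with Crossing.∈-segment C z∈
    ... | r , r≤len , refl = let (good , in-S) = P′∈ _ ; (t₀≤ , ≤t₁) = Crossing.in-band C r r≤len in
                             good , band⊆R in-S t₀≤ ≤t₁
  count≤ : suc len ℕ.+ suc (Crossing.len CQ) ℕ.≤ 2 ℕ.+ (Δ ℕ.+ (slack ℕ.+ slack) ℕ.+ h)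
  count≤ = subst (ℕ._≤ 2 ℕ.+ (Δ ℕ.+ (slack ℕ.+ slack) ℕ.+ h))
    (trans (length-++ (Crossing.segment CP))
           (cong₂ ℕ._+_ (Crossing.length-segment CP) (Crossing.length-segment CQ)))
    (bound R zs zs-Unique zs-good)

no-disjoint-paths-in-upward-strip : ∀ {S Good} → UpwardStrip S → RectangleBound Good →
  (P Q : InfSimplePath) → (∀ n → Good (vert P n) × S (vert P n)) → (∀ n → Good (vert Q n) × S (vert Q n)) →
  (∀ m n → vert P m ≢ vert Q n) → ⊥
no-disjoint-paths-in-upward-strip strip bound P Q P∈ Q∈ disjoint =
  disjoint-crossings-impossible strip bound P∈ Q∈ disjoint
    (crosses strip P (proj₂ ∘ P∈) (ℤ.≤-trans (i≤+∣i∣ qP) (+≤+ (ℕ.m≤m+n ℤ.∣ qP ∣ ℤ.∣ qQ ∣))) h)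
    (crosses strip Q (proj₂ ∘ Q∈) (ℤ.≤-trans (i≤+∣i∣ qQ) (+≤+ (ℕ.m≤n+m ℤ.∣ qQ ∣ ℤ.∣ qP ∣))) h)
  where
  qP qQ : ℤ
  qP = row (vert P 0)
  qQ = row (vert Q 0)
  h : ℕ
  h = suc (UpwardStrip.slack strip ℕ.+ UpwardStrip.slack strip)

corollary3p10 : (M : Subset) → Minimal M → ¬ TwoPathsInStrip M
corollary3p10 M minimal (P , Q , δP , δQ , disjoint , H , P∈H , Q∈H) =
  no-disjoint-paths-in-upward-strip
    (upward-strip (turn-strips k H) points-up)
    (RectangleBound-unrotate k (rectangle-bound minimal))
    (rotatePath k P) (rotatePath k Q)
    (λ n → InDelta-rotated P δP n , InHalfStrip-rotate k H (P∈H n))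
    (λ n → InDelta-rotated Q δQ n , InHalfStrip-rotate k H (Q∈H n))
    (λ m n e → disjoint m n (rotate-injective k e))
  where
  k : ℕ
  k = proj₁ (turn-upward H)
  points-up : PointsUp (turn-strips k H)
  points-up = proj₂ (turn-upward H)
  InDelta-rotated : ∀ R → (∀ n → InDelta M (vert R n)) → ∀ n → InDelta M (unrotate k (rotate k (vert R n)))
  InDelta-rotated R δR n = subst (InDelta M) (sym (unrotate-rotate k (vert R n))) (δR n)
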